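{- Fix an integer $h\ge1$. As formal multivariate Dirichlet series, $$\mathcal E^e_{\mathcal D}(s_1,\dots,s_h;h)=\mathcal Z(s_1,\dots,s_h)^2,\qquad \mathcal E^p_{\mathcal D}(s_1,\dots,s_h;h)=\mathcal Z^\blacktriangle(s_1,\dots,s_h)^2,$$ and, as formal power series, $$\mathcal E^e(x_1,\dots,x_h;h)=\sum_{n_1\ge\dots\ge n_h\ge1}\frac{x_1^{n_1}\cdots x_h^{n_h}}{(1-x_1^{n_1})(1-x_1^{n_1}x_2^{n_2})\cdots(1-x_1^{n_1}\cdots x_h^{n_h})},$$ $$\mathcal E^p(x_1,\dots,x_h;h)=\sum_{n_1\ge\dots\ge n_h\ge1}\frac{(n_1-n_2+1)\cdots(n_{h-1}-n_h+1)\,x_1^{n_1}\cdots x_h^{n_h}}{(1-x_1^{n_1})^2(1-x_1^{n_1}x_2^{n_2})^2\cdots(1-x_1^{n_1}\cdots x_{h-1}^{n_{h-1}})^2(1-x_1^{n_1}\cdots x_h^{n_h})}.$$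
   Context: An espalier of height $h$ is a set of unit cells of $\mathbb Z^3$ of the form $\bigcup_{a=0}^{h-1}\{a\}\times\{0,\dots,p_a-1\}\times\{0,\dots,q_a-1\}$ with integers $p_0\ge\dots\ge p_{h-1}\ge1$, $q_0\ge\dots\ge q_{h-1}\ge1$. A pyramid of height $h$ is a set of cells of the form $\bigcup_{a=0}^{h-1}\{a\}\times R_a$, where $R_a=\{b_a,\dots,b_a+p_a-1\}\times\{c_a,\dots,c_a+q_a-1\}$ with $p_a,q_a\ge1$, $b_0=c_0=0$ and $R_a\subseteq R_{a-1}$ for $a\ge1$ (so espaliers are the pyramids with all $b_a=c_a=0$). The $(a+1)$-th plateau $\{a\}\times R_a$ has volume $p_aq_a$. For $t\in\{e,p\}$, $n^t_{[m_1,\dots,m_h]}$ is the number of espaliers ($t=e$) resp. pyramids ($t=p$) of height $h$ whose $i$-th plateau has volume $m_i$, $i=1,\dots,h$ (nonzero only if $m_1\ge\dots\ge m_h\ge1$). Define $\mathcal E^t(x_1,\dots,x_h;h)=\sum_{m_1\ge\dots\ge m_h\ge1}n^t_{[m_1,\dots,m_h]}x_1^{m_1}\cdots x_h^{m_h}$ and $\mathcal E^t_{\mathcal D}(s_1,\dots,s_h;h)=\sum_{m_1\ge\dots\ge m_h\ge1}\frac{n^t_{[m_1,\dots,m_h]}}{m_1^{s_1}\cdots m_h^{s_h}}$. Also $\mathcal Z(s_1,\dots,s_h)=\sum_{n_1\ge\dots\ge n_h\ge1}\frac{1}{n_1^{s_1}\cdots n_h^{s_h}}$ and $\mathcal Z^\blacktriangle(s_1,\dots,s_h)=\sum_{n_1\ge\dots\ge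 n_h\ge1}\frac{(n_1-n_2+1)\cdots(n_{h-1}-n_h+1)}{n_1^{s_1}\cdots n_h^{s_h}}$, formal Dirichlet series multiplied via $n^{ -s}m^{ -s}=(nm)^{ -s}$ in each variable. -}

module Defs where

open import Data.Nat using (ℕ; zero; suc; _+_; _*_; _∸_; _≤ᵇ_; _<ᵇ_; _≡ᵇ_)
open import Data.Bool using (Bool; true; false; _∧_; if_then_else_)
open import Data.List using (List; []; _∷_; map; concatMap; upTo; foldr)
open import Data.Nat.ListAction using (sum)
open import Data.Vec using (Vec; []; _∷_; zipWith; replicate; tabulate; lookup)
import Data.Vec as V
open import Data.Fin using (Fin; toℕ)

ind : Bool → ℕ
ind true  = 1
ind false = 0

box : ∀ {h} → Vec ℕ h → List (Vec ℕ h)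
box []       = [] ∷ []
box (b ∷ bs) = concatMap (λ i → map (i ∷_) (box bs)) (upTo (suc b))

Σ∈ : ∀ {A : Set} → List A → (A → ℕ) → ℕ
Σ∈ xs f = sum (map f xs)

allPos : ∀ {h} → Vec ℕ h → Bool
allPos []       = true
allPos (x ∷ xs) = (1 ≤ᵇ x) ∧ allPos xs

nonincr⁺ : ∀ {h} → Vec ℕ h → Bool
nonincr⁺ []           = true
nonincr⁺ (x ∷ [])     = 1 ≤ᵇ x
nonincr⁺ (x ∷ y ∷ xs) = (y ≤ᵇ x) ∧ nonincr⁺ (y ∷ xs)

vecEq : ∀ {h} → Vec ℕ h → Vec ℕ h → Bool
vecEq []       []       = true
vecEq (x ∷ xs) (y ∷ ys) = (x ≡ᵇ y) ∧ vecEq xs ys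

-- Espaliers and pyramids (encoded by their defining parameters;
-- the parametrisations are injective, so counting parameters = counting sets)

-- Espalier with parameters p, q (p₀ ≥ … ≥ p_{h-1} ≥ 1, same for q)
-- whose plateau volumes p_a q_a form the vector m.
-- (p_a ≤ p_a q_a = m_a, so p, q range over box m without loss.)
nᵉ : ∀ {h} → Vec ℕ h → ℕ
nᵉ m = Σ∈ (box m) λ p → Σ∈ (box m) λ q →
         ind (nonincr⁺ p ∧ nonincr⁺ q ∧ vecEq (zipWith _*_ p q) m)

headZero : ∀ {h} → Vec ℕ h → Bool
headZero []      = true
headZero (x ∷ _) = x ≡ᵇ 0

-- intervals {b_a, …, b_a + p_a - 1} nested: interval a ⊆ interval (a-1)
nested : ∀ {h} → Vec ℕ h → Vec ℕ h → Bool
nested []            []            = true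
nested (b ∷ [])      (p ∷ [])      = true
nested (b ∷ b' ∷ bs) (p ∷ p' ∷ ps) =
  (b ≤ᵇ b') ∧ ((b' + p') ≤ᵇ (b + p)) ∧ nested (b' ∷ bs) (p' ∷ ps)

-- Pyramid with rectangles R_a = [b_a, b_a+p_a) × [c_a, c_a+q_a),
-- b₀ = c₀ = 0, p,q ≥ 1, R_a ⊆ R_{a-1}, plateau volumes p_a q_a = m_a.
isPyramid : ∀ {h} → Vec ℕ h → Vec ℕ h → Vec ℕ h → Vec ℕ h → Vec ℕ h → Bool
isPyramid b c p q m =
  headZero b ∧ headZero c ∧ allPos p ∧ allPos q ∧
  nested b p ∧ nested c q ∧ vecEq (zipWith _*_ p q) m

-- offsets satisfy b_a < p₀ ≤ m₀ ≤ Σ m, so the search range is exhaustive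
nᵖ : ∀ {h} → Vec ℕ h → ℕ
nᵖ {h} m =
  Σ∈ (box (replicate h (V.sum m))) λ b →
  Σ∈ (box (replicate h (V.sum m))) λ c →
  Σ∈ (box m) λ p → Σ∈ (box m) λ q → ind (isPyramid b c p q m)

-- Formal multivariate Dirichlet series: coefficient of m₁^{-s₁}⋯m_h^{-s_h}
-- (only indices with all mᵢ ≥ 1 are meaningful)

FDS : ℕ → Set
FDS h = Vec ℕ h → ℕ

-- product via n^{-s} m^{-s} = (nm)^{-s} in each variable
_⋆_ : ∀ {h} → FDS h → FDS h → FDS h
(f ⋆ g) m = Σ∈ (box m) λ a → Σ∈ (box m) λ b →
              ind (vecEq (zipWith _*_ a b) m) * (f a * g b)

gap : ∀ {h} → Vec ℕ h → ℕ
gap []           = 1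
gap (x ∷ [])     = 1
gap (x ∷ y ∷ xs) = (x ∸ y + 1) * gap (y ∷ xs)

𝒵 : ∀ {h} → FDS h
𝒵 n = ind (nonincr⁺ n)

𝒵▲ : ∀ {h} → FDS h
𝒵▲ n = ind (nonincr⁺ n) * gap n

𝓔ᵉ-D : ∀ {h} → FDS h
𝓔ᵉ-D m = ind (nonincr⁺ m) * nᵉ m

𝓔ᵖ-D : ∀ {h} → FDS h
𝓔ᵖ-D m = ind (nonincr⁺ m) * nᵖ m

-- Formal power series in x₁,…,x_h: coefficient of x^m

FPS : ℕ → Set
FPS h = Vec ℕ h → ℕ

X^ : ∀ {h} → Vec ℕ h → FPS h
X^ e m = ind (vecEq m e)

𝟙 : ∀ {h} → FPS h
𝟙 {h} = X^ (replicate h 0)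

_·_ : ∀ {h} → FPS h → FPS h → FPS h
(f · g) m = Σ∈ (box m) λ a → f a * g (zipWith _∸_ m a)

_•_ : ∀ {h} → ℕ → FPS h → FPS h
(c • f) m = c * f m

_^ps_ : ∀ {h} → FPS h → ℕ → FPS h
f ^ps zero  = 𝟙
f ^ps suc k = f · (f ^ps k)

Π : ∀ {h} → List (FPS h) → FPS h
Π = foldr _·_ 𝟙

-- 1/(1 - y) = Σ_{k ≥ 0} y^k for y with zero constant term; since y^k then
-- has total degree ≥ k, the terms k > |m| do not contribute to x^m.
geom : ∀ {h} → FPS h → FPS h
geom y m = Σ∈ (upTo (suc (V.sum m))) λ k → (y ^ps k) m

-- exponent vector of x₁^{n₁}⋯x_j^{n_j}
pref : ∀ {h} → Vec ℕ h → ℕ → Vec ℕ h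
pref n j = tabulate (λ i → if toℕ i <ᵇ j then lookup n i else 0)

-- Σ_{n₁ ≥ … ≥ n_h ≥ 1} T n, for families where T n is supported on
-- exponents ≥ n componentwise (true for the families below, each term
-- being x^n times a power series), so only n ≤ m contributes to x^m.
Σ⁺ : ∀ {h} → (Vec ℕ h → FPS h) → FPS h
Σ⁺ T m = Σ∈ (box m) λ n → ind (nonincr⁺ n) * T n m

𝓔ᵉ : ∀ {h} → FPS h
𝓔ᵉ m = ind (nonincr⁺ m) * nᵉ m

𝓔ᵖ : ∀ {h} → FPS h
𝓔ᵖ m = ind (nonincr⁺ m) * nᵖ m

invP : ∀ {h} → Vec ℕ h → ℕ → FPS h
invP n j = geom (X^ (pref n j))

rhsᵉ : (h : ℕ) → FPS h
rhsᵉ h = Σ⁺ λ n → X^ n · Π (map (invP n) (map suc (upTo h)))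

rhsᵖ : (h : ℕ) → FPS h
rhsᵖ h = Σ⁺ λ n → gap n •
  (X^ n · (Π (map (λ j → invP n j · invP n j) (map suc (upTo (h ∸ 1))))
           · invP n h))

module Submission where

open import Defs
open import Data.Nat using (ℕ; _≤_)
open import Data.Bool using (true)
open import Data.Vec using (Vec)
open import Data.Product using (_×_)
open import Relation.Binary.PropositionalEquality using (_≡_)

open import Data.Nat using (zero; suc; _+_; _*_; _∸_; _<_; _≤ᵇ_; _≡ᵇ_; z≤n; s≤s; >-nonZero)
open import Data.Nat.Properties
open import Data.Nat.ListAction using (sum)
open import Data.Nat.ListAction.Properties using (sum-++)
open import Data.Nat.Divisibility using (divides; _∣?_)
open import Data.Nat.Tactic.RingSolver using (solve-∀)
open import Algebra.Properties.CommutativeSemigroup *-commutativeSemigroup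
  using () renaming (interchange to *-interchange)
open import Data.Bool using (Bool; false; _∧_; T)
open import Data.Bool.Properties using (∧-identityʳ; ∧-zeroʳ)
open import Data.List using (List; []; _∷_; _++_; map; concatMap; upTo; applyUpTo)
open import Data.List.Properties using (map-∘; map-++; upTo-∷ʳ)
open import Data.List.Relation.Unary.All using (All; []; _∷_)
import Data.List.Relation.Unary.All as All
open import Data.List.Relation.Unary.All.Properties using (++⁺; ++⁻ˡ; ++⁻ʳ)
open import Data.Vec using ([]; _∷_; zipWith; replicate; tabulate)
import Data.Vec as V
open import Data.Fin using (Fin)
open import Data.Product using (_,_; proj₁; proj₂)
open import Data.Unit using (⊤; tt)
open import Data.Empty using (⊥; ⊥-elim)
open import Relation.Nullary using (¬_; yes; no)
open import Relation.Binary.PropositionalEquality hiding (_≡_)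
open import Function using (_∘_)

-- Everything is reduced to the box-sum form of the Dirichlet product,
-- Conv f g m = Σ_{p, q ≤ m, p·q = m} f p · g q, for f, g ∈ {𝒵, 𝒵▲}.
-- * Counting.  An espalier is a pair of nonincreasing side vectors p, q with
--   p·q = m, so nᵉ = Conv 𝒵 𝒵.  A pyramid adds offsets chosen independently
--   along the two axes; for nonincreasing p there are gap p nested chains of
--   intervals, so nᵖ = Conv 𝒵▲ 𝒵▲.  Since products of nonincreasing vectors
--   are nonincreasing, the factor ind (nonincr⁺ m) is absorbed.
-- * Power series.  Expanding 1/(1 - x₁^{n₁}⋯x_j^{n_j}) (squared: weights
--   k + 1), the coefficient of x^m in the n-th summand counts multiplicity
--   vectors; solving the resulting triangular system coordinate by coordinate
--   shows it is Σ_{q : n·q = m} 𝒵 q (resp. 𝒵▲ q), with q - 1 the partial sums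
--   of the multiplicities.  Summing over nonincreasing n gives Conv again.

T⇒≡true : ∀ {b} → T b → b ≡ true
T⇒≡true {true} _ = refl

≡true⇒T : ∀ {b} → b ≡ true → T b
≡true⇒T refl = tt

∧-split : ∀ {a b} → a ∧ b ≡ true → (a ≡ true) × (b ≡ true)
∧-split {true} {true} _ = refl , refl

∧-intro : ∀ {a b} → a ≡ true → b ≡ true → a ∧ b ≡ true
∧-intro refl refl = refl

ind-∧ : ∀ a b → ind (a ∧ b) ≡ ind a * ind b
ind-∧ true b = sym (+-identityʳ (ind b))
ind-∧ false b = refl

ind-∧-interchange : ∀ a b c d → ind (a ∧ b) * ind (c ∧ d) ≡ ind (a ∧ c) * ind (b ∧ d)
ind-∧-interchange a b c d
  rewrite ind-∧ a b | ind-∧ c d | ind-∧ a c | ind-∧ b d = *-interchange (ind a) (ind b) (ind c) (ind d)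

≤ᵇ-complete : ∀ {m n} → m ≤ n → (m ≤ᵇ n) ≡ true
≤ᵇ-complete p = T⇒≡true (≤⇒≤ᵇ p)

≤ᵇ-sound : ∀ m n → (m ≤ᵇ n) ≡ true → m ≤ n
≤ᵇ-sound m n e = ≤ᵇ⇒≤ m n (≡true⇒T e)

≡ᵇ-sound : ∀ m n → (m ≡ᵇ n) ≡ true → m ≡ n
≡ᵇ-sound m n e = ≡ᵇ⇒≡ m n (≡true⇒T e)

≡ᵇ-complete : ∀ {m n} → m ≡ n → (m ≡ᵇ n) ≡ true
≡ᵇ-complete {m} {n} p = T⇒≡true (≡⇒≡ᵇ m n p)

ind≤ : ∀ {m n} → m ≤ n → ind (m ≤ᵇ n) ≡ 1
ind≤ p rewrite ≤ᵇ-complete p = refl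

ind≰ : ∀ {m n} → ¬ m ≤ n → ind (m ≤ᵇ n) ≡ 0
ind≰ {m} {n} np with m ≤ᵇ n in eq
... | true = ⊥-elim (np (≤ᵇ-sound m n eq))
... | false = refl

ind≡ : ∀ {m n} → m ≡ n → ind (m ≡ᵇ n) ≡ 1
ind≡ p rewrite ≡ᵇ-complete p = refl

ind≢ : ∀ {m n} → ¬ m ≡ n → ind (m ≡ᵇ n) ≡ 0
ind≢ {m} {n} np with m ≡ᵇ n in eq
... | true = ⊥-elim (np (≡ᵇ-sound m n eq))
... | false = refl

suc≤ᵇsuc : ∀ a b → (suc a ≤ᵇ suc b) ≡ (a ≤ᵇ b)
suc≤ᵇsuc zero b = refl
suc≤ᵇsuc (suc a) b = refl

Σ< : ℕ → (ℕ → ℕ) → ℕ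
Σ< zero F = 0
Σ< (suc n) F = F 0 + Σ< n (λ i → F (suc i))

Σ<-cong : ∀ n {F G : ℕ → ℕ} → (∀ i → i < n → F i ≡ G i) → Σ< n F ≡ Σ< n G
Σ<-cong zero eq = refl
Σ<-cong (suc n) eq = cong₂ _+_ (eq 0 (s≤s z≤n)) (Σ<-cong n (λ i p → eq (suc i) (s≤s p)))

Σ<-cong′ : ∀ n {F G : ℕ → ℕ} → (∀ i → F i ≡ G i) → Σ< n F ≡ Σ< n G
Σ<-cong′ n eq = Σ<-cong n (λ i _ → eq i)

Σ<-zero : ∀ n {F : ℕ → ℕ} → (∀ i → i < n → F i ≡ 0) → Σ< n F ≡ 0
Σ<-zero zero z = refl
Σ<-zero (suc n) z = cong₂ _+_ (z 0 (s≤s z≤n)) (Σ<-zero n (λ i p → z (suc i) (s≤s p)))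

Σ<-+ : ∀ n (F G : ℕ → ℕ) → Σ< n (λ i → F i + G i) ≡ Σ< n F + Σ< n G
Σ<-+ zero F G = refl
Σ<-+ (suc n) F G rewrite Σ<-+ n (F ∘ suc) (G ∘ suc) =
  regroup (F 0) (G 0) (Σ< n (F ∘ suc)) (Σ< n (G ∘ suc))
  where
  regroup : ∀ a b c d → a + b + (c + d) ≡ a + c + (b + d)
  regroup = solve-∀

Σ<-*ˡ : ∀ n c (F : ℕ → ℕ) → Σ< n (λ i → c * F i) ≡ c * Σ< n F
Σ<-*ˡ zero c F = sym (*-zeroʳ c)
Σ<-*ˡ (suc n) c F rewrite Σ<-*ˡ n c (F ∘ suc) = sym (*-distribˡ-+ c (F 0) (Σ< n (F ∘ suc)))

Σ<-*ʳ : ∀ n c (F : ℕ → ℕ) → Σ< n (λ i → F i * c) ≡ Σ< n F * c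
Σ<-*ʳ n c F = trans (Σ<-cong′ n (λ i → *-comm (F i) c))
                    (trans (Σ<-*ˡ n c F) (*-comm c (Σ< n F)))

Σ<-swap : ∀ n m (F : ℕ → ℕ → ℕ) →
  Σ< n (λ i → Σ< m (λ j → F i j)) ≡ Σ< m (λ j → Σ< n (λ i → F i j))
Σ<-swap zero m F = sym (Σ<-zero m (λ _ _ → refl))
Σ<-swap (suc n) m F =
  trans (cong (Σ< m (F 0) +_) (Σ<-swap n m (F ∘ suc)))
        (sym (Σ<-+ m (F 0) (λ j → Σ< n (λ i → F (suc i) j))))

Σ<-single : ∀ n i₀ {F : ℕ → ℕ} → i₀ < n → (∀ i → i < n → ¬ i ≡ i₀ → F i ≡ 0) → Σ< n F ≡ F i₀
Σ<-single (suc n) zero _ z =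
  trans (cong (_ +_) (Σ<-zero n (λ i p → z (suc i) (s≤s p) (λ ())))) (+-identityʳ _)
Σ<-single (suc n) (suc i₀) {F} (s≤s lt) z =
  trans (cong (_+ Σ< n (F ∘ suc)) (z 0 (s≤s z≤n) (λ ())))
        (Σ<-single n i₀ lt (λ i p ne → z (suc i) (s≤s p) (ne ∘ suc-injective)))

Σ<-delta : ∀ m v (F : ℕ → ℕ) → Σ< (suc m) (λ i → ind (i ≡ᵇ v) * F i) ≡ ind (v ≤ᵇ m) * F v
Σ<-delta m zero F = trans (cong (_ +_) (Σ<-zero m (λ _ _ → refl))) (+-identityʳ _)
Σ<-delta zero (suc v) F = refl
Σ<-delta (suc m) (suc v) F =
  trans (Σ<-delta m v (F ∘ suc)) (cong (λ b → ind b * F (suc v)) (sym (suc≤ᵇsuc v m)))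

Σ<-extend : ∀ M N {F : ℕ → ℕ} → M ≤ N → (∀ i → M ≤ i → i < N → F i ≡ 0) → Σ< N F ≡ Σ< M F
Σ<-extend zero N le z = Σ<-zero N (λ i p → z i z≤n p)
Σ<-extend (suc M) (suc N) (s≤s le) z =
  cong (_ +_) (Σ<-extend M N le (λ i p q → z (suc i) (s≤s p) (s≤s q)))

Σ∈-cong : ∀ {A : Set} (xs : List A) {f g : A → ℕ} → (∀ x → f x ≡ g x) → Σ∈ xs f ≡ Σ∈ xs g
Σ∈-cong [] eq = refl
Σ∈-cong (x ∷ xs) eq = cong₂ _+_ (eq x) (Σ∈-cong xs eq)

Σ∈-map : ∀ {A B : Set} (g : A → B) (xs : List A) (f : B → ℕ) → Σ∈ (map g xs) f ≡ Σ∈ xs (f ∘ g)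
Σ∈-map g [] f = refl
Σ∈-map g (x ∷ xs) f = cong (f (g x) +_) (Σ∈-map g xs f)

Σ∈-concatMap : ∀ {A B : Set} (g : A → List B) (xs : List A) (f : B → ℕ) →
  Σ∈ (concatMap g xs) f ≡ Σ∈ xs (λ x → Σ∈ (g x) f)
Σ∈-concatMap g [] f = refl
Σ∈-concatMap g (x ∷ xs) f = begin
    sum (map f (g x ++ concatMap g xs))
      ≡⟨ cong sum (map-++ f (g x) (concatMap g xs)) ⟩
    sum (map f (g x) ++ map f (concatMap g xs))
      ≡⟨ sum-++ (map f (g x)) _ ⟩
    Σ∈ (g x) f + Σ∈ (concatMap g xs) f
      ≡⟨ cong (Σ∈ (g x) f +_) (Σ∈-concatMap g xs f) ⟩
    Σ∈ (g x) f + Σ∈ xs (λ y → Σ∈ (g y) f) ∎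
  where open ≡-Reasoning

Σ∈-upTo : ∀ n (F : ℕ → ℕ) → Σ∈ (upTo n) F ≡ Σ< n F
Σ∈-upTo = go (λ i → i)
  where
  go : ∀ (f : ℕ → ℕ) n (F : ℕ → ℕ) → Σ∈ (applyUpTo f n) F ≡ Σ< n (F ∘ f)
  go f zero F = refl
  go f (suc n) F = cong (F (f 0) +_) (go (f ∘ suc) n F)

BoxΣ : ∀ {h} → Vec ℕ h → (Vec ℕ h → ℕ) → ℕ
BoxΣ [] F = F []
BoxΣ (m ∷ ms) F = Σ< (suc m) (λ i → BoxΣ ms (λ a → F (i ∷ a)))

Σ∈-box : ∀ {h} (m : Vec ℕ h) (F : Vec ℕ h → ℕ) → Σ∈ (box m) F ≡ BoxΣ m F
Σ∈-box [] F = +-identityʳ (F [])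
Σ∈-box (m ∷ ms) F = begin
    Σ∈ (concatMap (λ i → map (i ∷_) (box ms)) (upTo (suc m))) F
      ≡⟨ Σ∈-concatMap (λ i → map (i ∷_) (box ms)) (upTo (suc m)) F ⟩
    Σ∈ (upTo (suc m)) (λ i → Σ∈ (map (i ∷_) (box ms)) F)
      ≡⟨ Σ∈-cong (upTo (suc m)) (λ i → trans (Σ∈-map (i ∷_) (box ms) F) (Σ∈-box ms (λ a → F (i ∷ a)))) ⟩
    Σ∈ (upTo (suc m)) (λ i → BoxΣ ms (λ a → F (i ∷ a)))
      ≡⟨ Σ∈-upTo (suc m) _ ⟩
    BoxΣ (m ∷ ms) F ∎
  where open ≡-Reasoning

Σ∈-box² : ∀ {h h'} (m : Vec ℕ h) (m' : Vec ℕ h') (F : Vec ℕ h → Vec ℕ h' → ℕ) →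
  Σ∈ (box m) (λ a → Σ∈ (box m') (F a)) ≡ BoxΣ m (λ a → BoxΣ m' (F a))
Σ∈-box² m m' F = trans (Σ∈-cong (box m) (λ a → Σ∈-box m' (F a))) (Σ∈-box m (λ a → BoxΣ m' (F a)))

leqV : ∀ {h} → Vec ℕ h → Vec ℕ h → Bool
leqV [] [] = true
leqV (x ∷ xs) (y ∷ ys) = (x ≤ᵇ y) ∧ leqV xs ys

BoxΣ-cong : ∀ {h} (m : Vec ℕ h) {F G : Vec ℕ h → ℕ} →
  (∀ a → leqV a m ≡ true → F a ≡ G a) → BoxΣ m F ≡ BoxΣ m G
BoxΣ-cong [] eq = eq [] refl
BoxΣ-cong (m ∷ ms) eq = Σ<-cong (suc m) (λ { i (s≤s i≤m) →
  BoxΣ-cong ms (λ a le → eq (i ∷ a) (∧-intro (≤ᵇ-complete i≤m) le)) })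

BoxΣ-cong′ : ∀ {h} (m : Vec ℕ h) {F G : Vec ℕ h → ℕ} → (∀ a → F a ≡ G a) → BoxΣ m F ≡ BoxΣ m G
BoxΣ-cong′ m eq = BoxΣ-cong m (λ a _ → eq a)

BoxΣ-*ˡ : ∀ {h} (m : Vec ℕ h) c (F : Vec ℕ h → ℕ) → BoxΣ m (λ a → c * F a) ≡ c * BoxΣ m F
BoxΣ-*ˡ [] c F = refl
BoxΣ-*ˡ (m ∷ ms) c F =
  trans (Σ<-cong′ (suc m) (λ i → BoxΣ-*ˡ ms c (λ a → F (i ∷ a))))
        (Σ<-*ˡ (suc m) c (λ i → BoxΣ ms (λ a → F (i ∷ a))))

BoxΣ-*ʳ : ∀ {h} (m : Vec ℕ h) c (F : Vec ℕ h → ℕ) → BoxΣ m (λ a → F a * c) ≡ BoxΣ m F * c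
BoxΣ-*ʳ m c F = trans (BoxΣ-cong′ m (λ a → *-comm (F a) c))
                      (trans (BoxΣ-*ˡ m c F) (*-comm c (BoxΣ m F)))

BoxΣ-zero : ∀ {h} (m : Vec ℕ h) {F : Vec ℕ h → ℕ} → (∀ a → F a ≡ 0) → BoxΣ m F ≡ 0
BoxΣ-zero [] z = z []
BoxΣ-zero (m ∷ ms) z = Σ<-zero (suc m) (λ i _ → BoxΣ-zero ms (λ a → z (i ∷ a)))

BoxΣ-Σ< : ∀ {h} (m : Vec ℕ h) n (F : Vec ℕ h → ℕ → ℕ) →
  BoxΣ m (λ a → Σ< n (F a)) ≡ Σ< n (λ k → BoxΣ m (λ a → F a k))
BoxΣ-Σ< [] n F = refl
BoxΣ-Σ< (m ∷ ms) n F =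
  trans (Σ<-cong′ (suc m) (λ i → BoxΣ-Σ< ms n (λ a → F (i ∷ a))))
        (Σ<-swap (suc m) n (λ i k → BoxΣ ms (λ a → F (i ∷ a) k)))

BoxΣ-swap : ∀ {h h'} (m : Vec ℕ h) (m' : Vec ℕ h') (F : Vec ℕ h → Vec ℕ h' → ℕ) →
  BoxΣ m (λ a → BoxΣ m' (F a)) ≡ BoxΣ m' (λ b → BoxΣ m (λ a → F a b))
BoxΣ-swap [] m' F = refl
BoxΣ-swap (m ∷ ms) m' F =
  trans (Σ<-cong′ (suc m) (λ i → BoxΣ-swap ms m' (λ a → F (i ∷ a))))
        (sym (BoxΣ-Σ< m' (suc m) (λ b i → BoxΣ ms (λ a → F (i ∷ a) b))))

vecEq-sound : ∀ {h} (a b : Vec ℕ h) → vecEq a b ≡ true → a ≡ b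
vecEq-sound [] [] _ = refl
vecEq-sound (x ∷ xs) (y ∷ ys) e with ∧-split {x ≡ᵇ y} e
... | e₁ , e₂ = cong₂ _∷_ (≡ᵇ-sound x y e₁) (vecEq-sound xs ys e₂)

vecEq-refl : ∀ {h} (a : Vec ℕ h) → vecEq a a ≡ true
vecEq-refl [] = refl
vecEq-refl (x ∷ xs) = ∧-intro (≡ᵇ-complete {x} refl) (vecEq-refl xs)

ind-vecEq-≢ : ∀ {h} {a b : Vec ℕ h} → ¬ a ≡ b → ind (vecEq a b) ≡ 0
ind-vecEq-≢ {a = a} {b} ne with vecEq a b in e
... | true = ⊥-elim (ne (vecEq-sound a b e))
... | false = refl

BoxΣ-delta : ∀ {h} (m v : Vec ℕ h) (F : Vec ℕ h → ℕ) →
  BoxΣ m (λ a → ind (vecEq a v) * F a) ≡ ind (leqV v m) * F v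
BoxΣ-delta [] [] F = refl
BoxΣ-delta (m ∷ ms) (v ∷ vs) F = begin
    Σ< (suc m) (λ i → BoxΣ ms (λ a → ind ((i ≡ᵇ v) ∧ vecEq a vs) * F (i ∷ a)))
      ≡⟨ Σ<-cong′ (suc m) (λ i → trans (BoxΣ-cong′ ms (λ a → split i a))
                                      (BoxΣ-*ˡ ms (ind (i ≡ᵇ v)) _)) ⟩
    Σ< (suc m) (λ i → ind (i ≡ᵇ v) * BoxΣ ms (λ a → ind (vecEq a vs) * F (i ∷ a)))
      ≡⟨ Σ<-cong′ (suc m) (λ i → cong (ind (i ≡ᵇ v) *_) (BoxΣ-delta ms vs (λ a → F (i ∷ a)))) ⟩
    Σ< (suc m) (λ i → ind (i ≡ᵇ v) * (ind (leqV vs ms) * F (i ∷ vs)))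
      ≡⟨ Σ<-delta m v (λ i → ind (leqV vs ms) * F (i ∷ vs)) ⟩
    ind (v ≤ᵇ m) * (ind (leqV vs ms) * F (v ∷ vs))
      ≡⟨ sym (*-assoc (ind (v ≤ᵇ m)) _ _) ⟩
    ind (v ≤ᵇ m) * ind (leqV vs ms) * F (v ∷ vs)
      ≡⟨ cong (_* F (v ∷ vs)) (sym (ind-∧ (v ≤ᵇ m) (leqV vs ms))) ⟩
    ind ((v ≤ᵇ m) ∧ leqV vs ms) * F (v ∷ vs) ∎
  where
  open ≡-Reasoning
  split : ∀ i a → ind ((i ≡ᵇ v) ∧ vecEq a vs) * F (i ∷ a) ≡ ind (i ≡ᵇ v) * (ind (vecEq a vs) * F (i ∷ a))
  split i a = trans (cong (_* F (i ∷ a)) (ind-∧ (i ≡ᵇ v) (vecEq a vs))) (*-assoc (ind (i ≡ᵇ v)) _ _)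

Conv : ∀ {h} → FDS h → FDS h → FDS h
Conv f g m = BoxΣ m (λ p → BoxΣ m (λ q → ind (vecEq (zipWith _*_ p q) m) * (f p * g q)))

⋆-as-Conv : ∀ {h} (f g : FDS h) (m : Vec ℕ h) → (f ⋆ g) m ≡ Conv f g m
⋆-as-Conv f g m = Σ∈-box² m m _

nonincr-head : ∀ {h} (x : ℕ) (xs : Vec ℕ h) → nonincr⁺ (x ∷ xs) ≡ true → 1 ≤ x
nonincr-head x [] e = ≤ᵇ-sound 1 x e
nonincr-head x (y ∷ xs) e with ∧-split {y ≤ᵇ x} e
... | e₁ , e₂ = ≤-trans (nonincr-head y xs e₂) (≤ᵇ-sound y x e₁)

nonincr⇒allPos : ∀ {h} (n : Vec ℕ h) → nonincr⁺ n ≡ true → allPos n ≡ true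
nonincr⇒allPos [] _ = refl
nonincr⇒allPos (x ∷ []) e = ∧-intro e refl
nonincr⇒allPos (x ∷ y ∷ xs) e =
  ∧-intro (≤ᵇ-complete (nonincr-head x (y ∷ xs) e)) (nonincr⇒allPos (y ∷ xs) (proj₂ (∧-split {y ≤ᵇ x} e)))

nonincr-zipWith-* : ∀ {h} (p q : Vec ℕ h) → nonincr⁺ p ≡ true → nonincr⁺ q ≡ true →
  nonincr⁺ (zipWith _*_ p q) ≡ true
nonincr-zipWith-* [] [] _ _ = refl
nonincr-zipWith-* (x ∷ []) (y ∷ []) hp hq =
  ≤ᵇ-complete (*-mono-≤ (≤ᵇ-sound 1 x hp) (≤ᵇ-sound 1 y hq))
nonincr-zipWith-* (x ∷ x' ∷ xs) (y ∷ y' ∷ ys) hp hq =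
  ∧-intro (≤ᵇ-complete (*-mono-≤ (≤ᵇ-sound x' x (proj₁ sp)) (≤ᵇ-sound y' y (proj₁ sq))))
          (nonincr-zipWith-* (x' ∷ xs) (y' ∷ ys) (proj₂ sp) (proj₂ sq))
  where
  sp = ∧-split {x' ≤ᵇ x} hp
  sq = ∧-split {y' ≤ᵇ y} hq

Supported : ∀ {h} → FDS h → Set
Supported f = ∀ p → nonincr⁺ p ≡ false → f p ≡ 0

𝒵-supported : ∀ {h} → Supported (𝒵 {h})
𝒵-supported p e rewrite e = refl

𝒵▲-supported : ∀ {h} → Supported (𝒵▲ {h})
𝒵▲-supported p e rewrite e = refl

Conv-supported : ∀ {h} {f g : FDS h} → Supported f → Supported g →
  ∀ m → ind (nonincr⁺ m) * Conv f g m ≡ Conv f g m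
Conv-supported {f = f} {g} sf sg m =
  trans (sym (BoxΣ-*ˡ m (ind (nonincr⁺ m)) _))
        (BoxΣ-cong′ m (λ p → trans (sym (BoxΣ-*ˡ m (ind (nonincr⁺ m)) _)) (BoxΣ-cong′ m (absorb p))))
  where
  absorb : ∀ p q → ind (nonincr⁺ m) * (ind (vecEq (zipWith _*_ p q) m) * (f p * g q))
                 ≡ ind (vecEq (zipWith _*_ p q) m) * (f p * g q)
  absorb p q with vecEq (zipWith _*_ p q) m in ee | nonincr⁺ p in ep | nonincr⁺ q in eq
  ... | false | _ | _ = *-zeroʳ (ind (nonincr⁺ m))
  ... | true | false | _ rewrite sf p ep = *-zeroʳ (ind (nonincr⁺ m))
  ... | true | true | false rewrite sg q eq | *-zeroʳ (f p) = *-zeroʳ (ind (nonincr⁺ m))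
  ... | true | true | true = trans (cong (λ b → ind b * _) m-nonincr) (*-identityˡ _)
    where
    m-nonincr : nonincr⁺ m ≡ true
    m-nonincr = subst (λ v → nonincr⁺ v ≡ true) (vecEq-sound (zipWith _*_ p q) m ee) (nonincr-zipWith-* p q ep eq)

espalier-count : ∀ {h} (m : Vec ℕ h) → nᵉ m ≡ Conv 𝒵 𝒵 m
espalier-count m = trans (Σ∈-box² m m _) (BoxΣ-cong′ m (λ p → BoxΣ-cong′ m (λ q → regroup p q)))
  where
  regroup : ∀ p q → ind (nonincr⁺ p ∧ nonincr⁺ q ∧ vecEq (zipWith _*_ p q) m)
                  ≡ ind (vecEq (zipWith _*_ p q) m) * (ind (nonincr⁺ p) * ind (nonincr⁺ q))
  regroup p q rewrite ind-∧ (nonincr⁺ p) (nonincr⁺ q ∧ vecEq (zipWith _*_ p q) m)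
                    | ind-∧ (nonincr⁺ q) (vecEq (zipWith _*_ p q) m) =
    rotate (ind (nonincr⁺ p)) (ind (nonincr⁺ q)) (ind (vecEq (zipWith _*_ p q) m))
    where
    rotate : ∀ a b c → a * (b * c) ≡ c * (a * b)
    rotate = solve-∀

-- For fixed side lengths the offsets along the two axes are
-- chosen independently, and for side lengths p₀ ≥ p₁ ≥ … the number of ways
-- to nest the intervals [b_a, b_a + p_a) is Π (p_a - p_{a+1} + 1) = gap p.

interval-positions : ∀ M x c d → d < M →
  Σ< M (λ y → ind (x ≤ᵇ y) * ind ((y + c) ≤ᵇ d)) ≡ suc d ∸ (x + c)
interval-positions (suc M) x c zero _ =
  trans (cong (ind (x ≤ᵇ 0) * ind (c ≤ᵇ 0) +_) (Σ<-zero M (λ i _ → *-zeroʳ (ind (x ≤ᵇ suc i)))))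
        (trans (+-identityʳ _) (at-zero x c))
  where
  at-zero : ∀ x c → ind (x ≤ᵇ 0) * ind (c ≤ᵇ 0) ≡ 1 ∸ (x + c)
  at-zero zero zero = refl
  at-zero zero (suc c) = sym (0∸n≡0 c)
  at-zero (suc x) c = sym (0∸n≡0 (x + c))
interval-positions (suc M) zero c (suc d) (s≤s lt) =
  trans (cong₂ _+_ (+-identityʳ (ind (c ≤ᵇ suc d)))
          (trans (Σ<-cong′ M (λ y → cong (λ b → ind b + 0) (suc≤ᵇsuc (y + c) d)))
                 (interval-positions M zero c d lt)))
        (first-position c d)
  where
  first-position : ∀ c d → ind (c ≤ᵇ suc d) + (suc d ∸ c) ≡ suc (suc d) ∸ c
  first-position zero d = refl
  first-position (suc c) d with c ≤? d
  ... | yes c≤d rewrite ind≤ {suc c} {suc d} (s≤s c≤d) = sym (+-∸-assoc 1 c≤d)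
  ... | no c≰d rewrite ind≰ {suc c} {suc d} (λ { (s≤s p) → c≰d p })
                     | m≤n⇒m∸n≡0 (≰⇒> c≰d) = m≤n⇒m∸n≡0 (≤-trans (n≤1+n d) (≰⇒> c≰d))
interval-positions (suc M) (suc x) c (suc d) (s≤s lt) =
  trans (Σ<-cong′ M (λ y → cong₂ (λ a b → ind a * ind b) (suc≤ᵇsuc x y) (suc≤ᵇsuc (y + c) d)))
        (interval-positions M x c d lt)

nestedChains : ∀ {h} (N x p₀ : ℕ) (ps : Vec ℕ h) → ℕ
nestedChains {h} N x p₀ ps = BoxΣ (replicate h N) (λ b → ind (nested (x ∷ b) (p₀ ∷ ps)))

nestedChains-step : ∀ {h} N x p₀ p₁ (ps : Vec ℕ h) →
  nestedChains N x p₀ (p₁ ∷ ps)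
  ≡ Σ< (suc N) (λ y → ind (x ≤ᵇ y) * (ind ((y + p₁) ≤ᵇ (x + p₀)) * nestedChains N y p₁ ps))
nestedChains-step {h} N x p₀ p₁ ps = Σ<-cong′ (suc N) (λ y →
  trans (BoxΣ-cong′ (replicate h N) (λ b →
          trans (ind-∧ (x ≤ᵇ y) _) (cong (ind (x ≤ᵇ y) *_) (ind-∧ ((y + p₁) ≤ᵇ (x + p₀)) (nested (y ∷ b) (p₁ ∷ ps))))))
  (trans (BoxΣ-*ˡ (replicate h N) (ind (x ≤ᵇ y)) (λ b → ind ((y + p₁) ≤ᵇ (x + p₀)) * ind (nested (y ∷ b) (p₁ ∷ ps))))
         (cong (ind (x ≤ᵇ y) *_) (BoxΣ-*ˡ (replicate h N) (ind ((y + p₁) ≤ᵇ (x + p₀))) (λ b → ind (nested (y ∷ b) (p₁ ∷ ps)))))))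

-- The final bookkeeping of one step: 1 ≤ p₀ and p₀ + 1 - p₁ positions
-- combine into the test p₁ ≤ p₀ and the factor (p₀ - p₁ + 1) of gap.
gap-step : ∀ p₀ p₁ s g → (s ≡ true → 1 ≤ p₁) →
  ind (1 ≤ᵇ p₀) * ((suc p₀ ∸ p₁) * (ind s * g)) ≡ ind ((p₁ ≤ᵇ p₀) ∧ s) * ((p₀ ∸ p₁ + 1) * g)
gap-step p₀ p₁ false g _ rewrite ∧-zeroʳ (p₁ ≤ᵇ p₀) | *-zeroʳ (suc p₀ ∸ p₁) = *-zeroʳ (ind (1 ≤ᵇ p₀))
gap-step p₀ p₁ true g p₁-pos with p₁ ≤? p₀
... | yes p₁≤p₀ rewrite ∧-identityʳ (p₁ ≤ᵇ p₀) | ind≤ p₁≤p₀ | ind≤ (≤-trans (p₁-pos refl) p₁≤p₀)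
                      | sym (+-∸-comm 1 p₁≤p₀) | +-comm p₀ 1 | *-identityˡ g = refl
... | no p₁≰p₀ rewrite ∧-identityʳ (p₁ ≤ᵇ p₀) | ind≰ p₁≰p₀ | m≤n⇒m∸n≡0 (≰⇒> p₁≰p₀) =
  *-zeroʳ (ind (1 ≤ᵇ p₀))

nestedChains-count : ∀ {h} N x p₀ (ps : Vec ℕ h) → x + p₀ ≤ N →
  ind (allPos (p₀ ∷ ps)) * nestedChains N x p₀ ps ≡ 𝒵▲ (p₀ ∷ ps)
nestedChains-count N x p₀ [] _ = cong (λ b → ind b * 1) (∧-identityʳ (1 ≤ᵇ p₀))
nestedChains-count N x p₀ (p₁ ∷ ps) x+p₀≤N = begin
    ind ((1 ≤ᵇ p₀) ∧ allPos (p₁ ∷ ps)) * nestedChains N x p₀ (p₁ ∷ ps)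
      ≡⟨ cong₂ _*_ (ind-∧ (1 ≤ᵇ p₀) (allPos (p₁ ∷ ps))) (nestedChains-step N x p₀ p₁ ps) ⟩
    ind (1 ≤ᵇ p₀) * A * Σ< (suc N) (λ y → inside y * (fits y * nestedChains N y p₁ ps))
      ≡⟨ trans (*-assoc (ind (1 ≤ᵇ p₀)) A _) (cong (ind (1 ≤ᵇ p₀) *_) (sym (Σ<-*ˡ (suc N) A (λ y → inside y * (fits y * nestedChains N y p₁ ps))))) ⟩
    ind (1 ≤ᵇ p₀) * Σ< (suc N) (λ y → A * (inside y * (fits y * nestedChains N y p₁ ps)))
      ≡⟨ cong (ind (1 ≤ᵇ p₀) *_) (Σ<-cong′ (suc N) recurse) ⟩
    ind (1 ≤ᵇ p₀) * Σ< (suc N) (λ y → (inside y * fits y) * C)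
      ≡⟨ cong (ind (1 ≤ᵇ p₀) *_) (Σ<-*ʳ (suc N) C (λ y → inside y * fits y)) ⟩
    ind (1 ≤ᵇ p₀) * (Σ< (suc N) (λ y → inside y * fits y) * C)
      ≡⟨ cong (λ z → ind (1 ≤ᵇ p₀) * (z * C)) positions ⟩
    ind (1 ≤ᵇ p₀) * ((suc p₀ ∸ p₁) * C)
      ≡⟨ gap-step p₀ p₁ (nonincr⁺ (p₁ ∷ ps)) (gap (p₁ ∷ ps)) (nonincr-head p₁ ps) ⟩
    𝒵▲ (p₀ ∷ p₁ ∷ ps) ∎
  where
  open ≡-Reasoning
  A = ind (allPos (p₁ ∷ ps))
  C = 𝒵▲ (p₁ ∷ ps)
  inside = λ y → ind (x ≤ᵇ y)
  fits = λ y → ind ((y + p₁) ≤ᵇ (x + p₀))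
  reorder : ∀ a b c d → a * (b * (c * d)) ≡ b * (c * (a * d))
  reorder = solve-∀
  recurse : ∀ y → A * (inside y * (fits y * nestedChains N y p₁ ps)) ≡ (inside y * fits y) * C
  recurse y with (y + p₁) ≤ᵇ (x + p₀) in e
  ... | true = trans (reorder A (inside y) 1 (nestedChains N y p₁ ps))
                 (trans (cong (λ z → inside y * (1 * z))
                   (nestedChains-count N y p₁ ps (≤-trans (≤ᵇ-sound (y + p₁) (x + p₀) e) x+p₀≤N)))
                   (sym (*-assoc (inside y) 1 C)))
  ... | false = trans (reorder A (inside y) 0 (nestedChains N y p₁ ps))
                      (sym (*-assoc (inside y) 0 C))
  positions : Σ< (suc N) (λ y → inside y * fits y) ≡ suc p₀ ∸ p₁
  positions = begin
      Σ< (suc N) (λ y → inside y * fits y)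
        ≡⟨ interval-positions (suc N) x p₁ (x + p₀) (s≤s x+p₀≤N) ⟩
      suc (x + p₀) ∸ (x + p₁)
        ≡⟨ cong (_∸ (x + p₁)) (sym (+-suc x p₀)) ⟩
      (x + suc p₀) ∸ (x + p₁)
        ≡⟨ [m+n]∸[m+o]≡n∸o x (suc p₀) p₁ ⟩
      suc p₀ ∸ p₁ ∎

offsets : ∀ {h} → ℕ → Vec ℕ h → ℕ
offsets {h} N p = ind (allPos p) * BoxΣ (replicate h N) (λ b → ind (headZero b) * ind (nested b p))

headBound : ∀ {h} → Vec ℕ h → ℕ → Set
headBound [] N = ⊤
headBound (x ∷ _) N = x ≤ N

offsets-count : ∀ {h} N (p : Vec ℕ h) → headBound p N → offsets N p ≡ 𝒵▲ p
offsets-count N [] _ = refl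
offsets-count {suc h} N (p₀ ∷ ps) p₀≤N =
  trans (cong (ind (allPos (p₀ ∷ ps)) *_) first-offset-zero) (nestedChains-count N 0 p₀ ps p₀≤N)
  where
  first-offset-zero : BoxΣ (N ∷ replicate h N) (λ b → ind (headZero b) * ind (nested b (p₀ ∷ ps)))
                    ≡ nestedChains N 0 p₀ ps
  first-offset-zero =
    trans (Σ<-cong′ (suc N) (λ i → BoxΣ-*ˡ (replicate h N) (ind (i ≡ᵇ 0)) (λ b → ind (nested (i ∷ b) (p₀ ∷ ps)))))
          (trans (Σ<-delta N 0 (λ i → nestedChains N i p₀ ps)) (*-identityˡ _))

headBound-box : ∀ {h} (p m : Vec ℕ h) → leqV p m ≡ true → headBound p (V.sum m)
headBound-box [] [] _ = tt
headBound-box (x ∷ p) (y ∷ m) e =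
  ≤-trans (≤ᵇ-sound x y (proj₁ (∧-split {x ≤ᵇ y} e))) (m≤m+n y (V.sum m))

BoxΣ-product : ∀ {h h'} (R : Vec ℕ h) (R' : Vec ℕ h') (F : Vec ℕ h → ℕ) (G : Vec ℕ h' → ℕ) →
  BoxΣ R (λ b → BoxΣ R' (λ c → F b * G c)) ≡ BoxΣ R F * BoxΣ R' G
BoxΣ-product R R' F G =
  trans (BoxΣ-cong′ R (λ b → BoxΣ-*ˡ R' (F b) G)) (BoxΣ-*ʳ R (BoxΣ R' G) F)

isPyramid-split : ∀ {h} (b c p q m : Vec ℕ h) →
  ind (isPyramid b c p q m)
  ≡ (ind (vecEq (zipWith _*_ p q) m) * (ind (allPos p) * ind (allPos q)))
    * ((ind (headZero b) * ind (nested b p)) * (ind (headZero c) * ind (nested c q)))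
isPyramid-split b c p q m
  rewrite ind-∧ (headZero b) (headZero c ∧ allPos p ∧ allPos q ∧ nested b p ∧ nested c q ∧ vecEq (zipWith _*_ p q) m)
        | ind-∧ (headZero c) (allPos p ∧ allPos q ∧ nested b p ∧ nested c q ∧ vecEq (zipWith _*_ p q) m)
        | ind-∧ (allPos p) (allPos q ∧ nested b p ∧ nested c q ∧ vecEq (zipWith _*_ p q) m)
        | ind-∧ (allPos q) (nested b p ∧ nested c q ∧ vecEq (zipWith _*_ p q) m)
        | ind-∧ (nested b p) (nested c q ∧ vecEq (zipWith _*_ p q) m)
        | ind-∧ (nested c q) (vecEq (zipWith _*_ p q) m) =
  regroup (ind (headZero b)) (ind (headZero c)) (ind (allPos p)) (ind (allPos q))
          (ind (nested b p)) (ind (nested c q)) (ind (vecEq (zipWith _*_ p q) m))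
  where
  regroup : ∀ hb hc ap aq nb nc e → hb * (hc * (ap * (aq * (nb * (nc * e)))))
                                   ≡ (e * (ap * aq)) * ((hb * nb) * (hc * nc))
  regroup = solve-∀

BoxΣ-swap² : ∀ {h h'} (R : Vec ℕ h) (m : Vec ℕ h') (F : Vec ℕ h → Vec ℕ h → Vec ℕ h' → Vec ℕ h' → ℕ) →
  BoxΣ R (λ b → BoxΣ R (λ c → BoxΣ m (λ p → BoxΣ m (F b c p))))
  ≡ BoxΣ m (λ p → BoxΣ m (λ q → BoxΣ R (λ b → BoxΣ R (λ c → F b c p q))))
BoxΣ-swap² R m F =
  trans (BoxΣ-cong′ R (λ b → BoxΣ-swap R m (λ c p → BoxΣ m (F b c p))))
  (trans (BoxΣ-swap R m (λ b p → BoxΣ R (λ c → BoxΣ m (F b c p))))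
  (BoxΣ-cong′ m (λ p → trans (BoxΣ-cong′ R (λ b → BoxΣ-swap R m (λ c q → F b c p q)))
                             (BoxΣ-swap R m (λ b q → BoxΣ R (λ c → F b c p q))))))

pyramids-with-sides : ∀ {h} (m p q : Vec ℕ h) → leqV p m ≡ true → leqV q m ≡ true →
  BoxΣ (replicate h (V.sum m)) (λ b → BoxΣ (replicate h (V.sum m)) (λ c → ind (isPyramid b c p q m)))
  ≡ ind (vecEq (zipWith _*_ p q) m) * (𝒵▲ p * 𝒵▲ q)
pyramids-with-sides {h} m p q p≤m q≤m = begin
    BoxΣ R (λ b → BoxΣ R (λ c → ind (isPyramid b c p q m)))
      ≡⟨ BoxΣ-cong′ R (λ b → BoxΣ-cong′ R (λ c → isPyramid-split b c p q m)) ⟩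
    BoxΣ R (λ b → BoxΣ R (λ c → E * (F b * G c)))
      ≡⟨ trans (BoxΣ-cong′ R (λ b → BoxΣ-*ˡ R E (λ c → F b * G c))) (BoxΣ-*ˡ R E _) ⟩
    E * BoxΣ R (λ b → BoxΣ R (λ c → F b * G c))
      ≡⟨ cong (E *_) (BoxΣ-product R R F G) ⟩
    (e * (ind (allPos p) * ind (allPos q))) * (BoxΣ R F * BoxΣ R G)
      ≡⟨ regroup e (ind (allPos p)) (ind (allPos q)) (BoxΣ R F) (BoxΣ R G) ⟩
    e * (offsets (V.sum m) p * offsets (V.sum m) q)
      ≡⟨ cong₂ (λ u v → e * (u * v)) (offsets-count (V.sum m) p (headBound-box p m p≤m))
                                      (offsets-count (V.sum m) q (headBound-box q m q≤m)) ⟩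
    e * (𝒵▲ p * 𝒵▲ q) ∎
  where
  open ≡-Reasoning
  R = replicate h (V.sum m)
  e = ind (vecEq (zipWith _*_ p q) m)
  E = e * (ind (allPos p) * ind (allPos q))
  F = λ b → ind (headZero b) * ind (nested b p)
  G = λ c → ind (headZero c) * ind (nested c q)
  regroup : ∀ e a a' s s' → (e * (a * a')) * (s * s') ≡ e * ((a * s) * (a' * s'))
  regroup = solve-∀

pyramid-count : ∀ {h} (m : Vec ℕ h) → nᵖ m ≡ Conv 𝒵▲ 𝒵▲ m
pyramid-count {h} m = begin
    nᵖ m
      ≡⟨ trans (Σ∈-cong (box R) (λ b → Σ∈-cong (box R) (λ c → Σ∈-box² m m (P b c)))) (Σ∈-box² R R _) ⟩
    BoxΣ R (λ b → BoxΣ R (λ c → BoxΣ m (λ p → BoxΣ m (P b c p))))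
      ≡⟨ BoxΣ-swap² R m P ⟩
    BoxΣ m (λ p → BoxΣ m (λ q → BoxΣ R (λ b → BoxΣ R (λ c → P b c p q))))
      ≡⟨ BoxΣ-cong m (λ p p≤m → BoxΣ-cong m (λ q q≤m → pyramids-with-sides m p q p≤m q≤m)) ⟩
    Conv 𝒵▲ 𝒵▲ m ∎
  where
  open ≡-Reasoning
  R = replicate h (V.sum m)
  P : Vec ℕ h → Vec ℕ h → Vec ℕ h → Vec ℕ h → ℕ
  P b c p q = ind (isPyramid b c p q m)

infixl 6 _-ᵥ_
_-ᵥ_ : ∀ {h} → Vec ℕ h → Vec ℕ h → Vec ℕ h
r -ᵥ a = zipWith _∸_ r a

scale : ∀ {h} → ℕ → Vec ℕ h → Vec ℕ h
scale k [] = []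
scale k (x ∷ xs) = k * x ∷ scale k xs

sub-≡-iff : ∀ e r f → ind (e ≤ᵇ r) * ind ((r ∸ e) ≡ᵇ f) ≡ ind (r ≡ᵇ (e + f))
sub-≡-iff e r f with e ≤? r
... | no e≰r rewrite ind≰ e≰r = sym (ind≢ λ eq → e≰r (subst (e ≤_) (sym eq) (m≤m+n e f)))
... | yes e≤r rewrite ind≤ e≤r with (r ∸ e) ≟ f
...   | yes eq rewrite ind≡ eq = sym (ind≡ (trans (sym (m+[n∸m]≡n e≤r)) (cong (e +_) eq)))
...   | no ne rewrite ind≢ ne = sym (ind≢ λ eq → ne (trans (cong (_∸ e) eq) (m+n∸m≡n e f)))

sub-≡-flip : ∀ a r v → a ≤ r → ind ((r ∸ a) ≡ᵇ v) ≡ ind (a ≡ᵇ (r ∸ v)) * ind (v ≤ᵇ r)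
sub-≡-flip a r v a≤r with v ≤? r
... | no v≰r rewrite ind≰ v≰r | *-zeroʳ (ind (a ≡ᵇ (r ∸ v))) =
  ind≢ λ eq → v≰r (subst (_≤ r) eq (m∸n≤m r a))
... | yes v≤r rewrite ind≤ v≤r | *-identityʳ (ind (a ≡ᵇ (r ∸ v))) with (r ∸ a) ≟ v
...   | yes eq rewrite ind≡ eq = sym (ind≡ (trans (sym (m∸[m∸n]≡n a≤r)) (cong (r ∸_) eq)))
...   | no ne rewrite ind≢ ne =
  sym (ind≢ {a} {r ∸ v} λ eq → ne (trans (cong (r ∸_) eq) (m∸[m∸n]≡n v≤r)))

sub-≤-iff : ∀ a b r → ind (a ≤ᵇ r) * ind (b ≤ᵇ (r ∸ a)) ≡ ind ((a + b) ≤ᵇ r)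
sub-≤-iff a b r with a ≤? r
... | no a≰r rewrite ind≰ a≰r = sym (ind≰ λ le → a≰r (≤-trans (m≤m+n a b) le))
... | yes a≤r rewrite ind≤ a≤r | *-identityˡ (ind (b ≤ᵇ (r ∸ a))) with b ≤? (r ∸ a)
...   | yes le rewrite ind≤ le = sym (ind≤ (subst (a + b ≤_) (m+[n∸m]≡n a≤r) (+-monoʳ-≤ a le)))
...   | no nle rewrite ind≰ nle =
  sym (ind≰ λ le → nle (subst (_≤ r ∸ a) (m+n∸m≡n a b) (∸-monoˡ-≤ a le)))

∸-swap : ∀ r a b → r ∸ a ∸ b ≡ r ∸ b ∸ a
∸-swap r a b = trans (∸-+-assoc r a b) (trans (cong (r ∸_) (+-comm a b)) (sym (∸-+-assoc r b a)))

sub-≡-iffᵥ : ∀ {h} (e r f : Vec ℕ h) →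
  ind (leqV e r) * ind (vecEq (r -ᵥ e) f) ≡ ind (vecEq r (zipWith _+_ e f))
sub-≡-iffᵥ [] [] [] = refl
sub-≡-iffᵥ (x ∷ e) (y ∷ r) (z ∷ f) =
  trans (ind-∧-interchange (x ≤ᵇ y) (leqV e r) ((y ∸ x) ≡ᵇ z) (vecEq (r -ᵥ e) f))
  (trans (cong₂ _*_ (trans (ind-∧ (x ≤ᵇ y) _) (sub-≡-iff x y z))
                    (trans (ind-∧ (leqV e r) _) (sub-≡-iffᵥ e r f)))
         (sym (ind-∧ (y ≡ᵇ (x + z)) _)))

sub-≡-flipᵥ : ∀ {h} (a r v : Vec ℕ h) → leqV a r ≡ true →
  ind (vecEq (r -ᵥ a) v) ≡ ind (vecEq a (r -ᵥ v)) * ind (leqV v r)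
sub-≡-flipᵥ [] [] [] _ = refl
sub-≡-flipᵥ (x ∷ a) (y ∷ r) (z ∷ v) le =
  trans (ind-∧ ((y ∸ x) ≡ᵇ z) _)
  (trans (cong₂ _*_ (sub-≡-flip x y z (≤ᵇ-sound x y (proj₁ sp))) (sub-≡-flipᵥ a r v (proj₂ sp)))
  (trans (*-interchange (ind (x ≡ᵇ (y ∸ z))) (ind (z ≤ᵇ y)) _ _)
         (sym (cong₂ _*_ (ind-∧ (x ≡ᵇ (y ∸ z)) _) (ind-∧ (z ≤ᵇ y) _)))))
  where sp = ∧-split {x ≤ᵇ y} le

sub-≤-commᵥ : ∀ {h} (a b r : Vec ℕ h) →
  ind (leqV a r) * ind (leqV b (r -ᵥ a)) ≡ ind (leqV b r) * ind (leqV a (r -ᵥ b))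
sub-≤-commᵥ [] [] [] = refl
sub-≤-commᵥ (x ∷ a) (y ∷ b) (z ∷ r) =
  trans (ind-∧-interchange (x ≤ᵇ z) (leqV a r) (y ≤ᵇ (z ∸ x)) _)
  (trans (cong₂ _*_ (trans (ind-∧ (x ≤ᵇ z) _) (trans head (sym (ind-∧ (y ≤ᵇ z) _))))
                    (trans (ind-∧ (leqV a r) _) (trans (sub-≤-commᵥ a b r) (sym (ind-∧ (leqV b r) _)))))
         (sym (ind-∧-interchange (y ≤ᵇ z) (leqV b r) (x ≤ᵇ (z ∸ y)) _)))
  where
  head : ind (x ≤ᵇ z) * ind (y ≤ᵇ (z ∸ x)) ≡ ind (y ≤ᵇ z) * ind (x ≤ᵇ (z ∸ y))
  head = trans (sub-≤-iff x y z) (trans (cong (λ s → ind (s ≤ᵇ z)) (+-comm x y)) (sym (sub-≤-iff y x z)))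

-ᵥ-swap : ∀ {h} (r a b : Vec ℕ h) → r -ᵥ a -ᵥ b ≡ r -ᵥ b -ᵥ a
-ᵥ-swap [] [] [] = refl
-ᵥ-swap (x ∷ r) (y ∷ a) (z ∷ b) = cong₂ _∷_ (∸-swap x y z) (-ᵥ-swap r a b)

sub-leq : ∀ {h} (r v : Vec ℕ h) → leqV (r -ᵥ v) r ≡ true
sub-leq [] [] = refl
sub-leq (x ∷ r) (y ∷ v) = ∧-intro (≤ᵇ-complete (m∸n≤m x y)) (sub-leq r v)

leq-sum : ∀ {h} (a r : Vec ℕ h) → leqV a r ≡ true → V.sum a ≤ V.sum r
leq-sum [] [] _ = z≤n
leq-sum (x ∷ a) (y ∷ r) e =
  +-mono-≤ (≤ᵇ-sound x y (proj₁ (∧-split {x ≤ᵇ y} e))) (leq-sum a r (proj₂ (∧-split {x ≤ᵇ y} e)))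

sum-sub : ∀ {h} (r a : Vec ℕ h) → V.sum (r -ᵥ a) ≤ V.sum r
sum-sub r a = leq-sum (r -ᵥ a) r (sub-leq r a)

sum-scale : ∀ {h} k (e : Vec ℕ h) → V.sum (scale k e) ≡ k * V.sum e
sum-scale k [] = sym (*-zeroʳ k)
sum-scale k (x ∷ e) = trans (cong (k * x +_) (sum-scale k e)) (sym (*-distribˡ-+ k x (V.sum e)))

scale-zero : ∀ {h} (e : Vec ℕ h) → scale 0 e ≡ replicate h 0
scale-zero [] = refl
scale-zero (x ∷ e) = cong (0 ∷_) (scale-zero e)

scale-suc : ∀ {h} k (e : Vec ℕ h) → zipWith _+_ e (scale k e) ≡ scale (suc k) e
scale-suc k [] = refl
scale-suc k (x ∷ e) = cong (x + k * x ∷_) (scale-suc k e)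

scale-+ : ∀ {h} i j (e : Vec ℕ h) → zipWith _+_ (scale i e) (scale j e) ≡ scale (i + j) e
scale-+ i j [] = refl
scale-+ i j (x ∷ e) = cong₂ _∷_ (sym (*-distribʳ-+ x i j)) (scale-+ i j e)

-- r = k e with Σ e ≥ 1 forces k ≤ Σ r; this bounds all geometric sums.
scale-too-big : ∀ {h} (r e : Vec ℕ h) k → 1 ≤ V.sum e → V.sum r < k → ind (vecEq r (scale k e)) ≡ 0
scale-too-big r e k e-pos lt = ind-vecEq-≢ {a = r} {b = scale k e} λ eq →
  <⇒≱ lt (subst (k ≤_) (sym (trans (cong V.sum eq) (sum-scale k e)))
            (subst (_≤ k * V.sum e) (*-identityʳ k) (*-monoʳ-≤ k e-pos)))

X^-shift : ∀ {h} (e : Vec ℕ h) (G : FPS h) (r : Vec ℕ h) → (X^ e · G) r ≡ ind (leqV e r) * G (r -ᵥ e)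
X^-shift e G r = trans (Σ∈-box r _) (BoxΣ-delta r e (λ a → G (r -ᵥ a)))

X^-power : ∀ {h} (e : Vec ℕ h) k (r : Vec ℕ h) → (X^ e ^ps k) r ≡ ind (vecEq r (scale k e))
X^-power e zero r = cong (λ v → ind (vecEq r v)) (sym (scale-zero e))
X^-power e (suc k) r = begin
    (X^ e · (X^ e ^ps k)) r
      ≡⟨ X^-shift e (X^ e ^ps k) r ⟩
    ind (leqV e r) * (X^ e ^ps k) (r -ᵥ e)
      ≡⟨ cong (ind (leqV e r) *_) (X^-power e k (r -ᵥ e)) ⟩
    ind (leqV e r) * ind (vecEq (r -ᵥ e) (scale k e))
      ≡⟨ sub-≡-iffᵥ e r (scale k e) ⟩
    ind (vecEq r (zipWith _+_ e (scale k e)))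
      ≡⟨ cong (λ v → ind (vecEq r v)) (scale-suc k e) ⟩
    ind (vecEq r (scale (suc k) e)) ∎
  where open ≡-Reasoning

-- F is the (truncation to total degree < B of the) series Σ_k w(k) x^{k e}.
WeightedGeom : ∀ {h} → ℕ → (ℕ → ℕ) → Vec ℕ h → FPS h → Set
WeightedGeom B w e F = ∀ b → V.sum b < B → F b ≡ Σ< B (λ k → w k * ind (vecEq b (scale k e)))

geom-weighted : ∀ {h} B (e : Vec ℕ h) → 1 ≤ V.sum e → WeightedGeom B (λ _ → 1) e (geom (X^ e))
geom-weighted B e e-pos r lt = begin
    geom (X^ e) r
      ≡⟨ Σ∈-upTo (suc (V.sum r)) _ ⟩
    Σ< (suc (V.sum r)) (λ k → (X^ e ^ps k) r)
      ≡⟨ Σ<-cong′ (suc (V.sum r)) (λ k → trans (X^-power e k r) (sym (*-identityˡ _))) ⟩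
    Σ< (suc (V.sum r)) (λ k → 1 * ind (vecEq r (scale k e)))
      ≡⟨ sym (Σ<-extend (suc (V.sum r)) B lt
               (λ k p _ → trans (*-identityˡ _) (scale-too-big r e k e-pos p))) ⟩
    Σ< B (λ k → 1 * ind (vecEq r (scale k e))) ∎
  where open ≡-Reasoning

weighted-· : ∀ {h} B (w : ℕ → ℕ) (e : Vec ℕ h) (F P : FPS h) → WeightedGeom B w e F →
  ∀ r → V.sum r < B →
  (F · P) r ≡ Σ< B (λ k → w k * (ind (leqV (scale k e) r) * P (r -ᵥ scale k e)))
weighted-· B w e F P F-geom r lt = begin
    (F · P) r
      ≡⟨ Σ∈-box r _ ⟩
    BoxΣ r (λ a → F a * P (r -ᵥ a))
      ≡⟨ BoxΣ-cong r (λ a a≤r →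
           trans (cong (_* P (r -ᵥ a)) (F-geom a (≤-<-trans (leq-sum a r a≤r) lt)))
                 (trans (sym (Σ<-*ʳ B (P (r -ᵥ a)) _)) (Σ<-cong′ B (λ k → *-assoc (w k) _ _)))) ⟩
    BoxΣ r (λ a → Σ< B (λ k → w k * (ind (vecEq a (scale k e)) * P (r -ᵥ a))))
      ≡⟨ BoxΣ-Σ< r B _ ⟩
    Σ< B (λ k → BoxΣ r (λ a → w k * (ind (vecEq a (scale k e)) * P (r -ᵥ a))))
      ≡⟨ Σ<-cong′ B (λ k → trans (BoxΣ-*ˡ r (w k) _)
            (cong (w k *_) (BoxΣ-delta r (scale k e) (λ a → P (r -ᵥ a))))) ⟩
    Σ< B (λ k → w k * (ind (leqV (scale k e) r) * P (r -ᵥ scale k e))) ∎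
  where open ≡-Reasoning

·-geom : ∀ {h} B (e : Vec ℕ h) → 1 ≤ V.sum e → (F : FPS h) →
  ∀ r → V.sum r < B →
  (F · geom (X^ e)) r ≡ Σ< B (λ k → ind (leqV (scale k e) r) * F (r -ᵥ scale k e))
·-geom B e e-pos F r lt = begin
    (F · geom (X^ e)) r
      ≡⟨ Σ∈-box r _ ⟩
    BoxΣ r (λ a → F a * geom (X^ e) (r -ᵥ a))
      ≡⟨ BoxΣ-cong′ r (λ a →
           trans (cong (F a *_) (geom-weighted B e e-pos (r -ᵥ a) (≤-<-trans (sum-sub r a) lt)))
           (trans (sym (Σ<-*ˡ B (F a) _))
             (Σ<-cong′ B (λ k → trans (cong (F a *_) (*-identityˡ _)) (*-comm (F a) _))))) ⟩
    BoxΣ r (λ a → Σ< B (λ k → ind (vecEq (r -ᵥ a) (scale k e)) * F a))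
      ≡⟨ BoxΣ-Σ< r B _ ⟩
    Σ< B (λ k → BoxΣ r (λ a → ind (vecEq (r -ᵥ a) (scale k e)) * F a))
      ≡⟨ Σ<-cong′ B (λ k → complement-delta (scale k e)) ⟩
    Σ< B (λ k → ind (leqV (scale k e) r) * F (r -ᵥ scale k e)) ∎
  where
  open ≡-Reasoning
  -- a ↦ r - a is an involution of the box below r
  complement-delta : ∀ v → BoxΣ r (λ a → ind (vecEq (r -ᵥ a) v) * F a) ≡ ind (leqV v r) * F (r -ᵥ v)
  complement-delta v = begin
      BoxΣ r (λ a → ind (vecEq (r -ᵥ a) v) * F a)
        ≡⟨ BoxΣ-cong r (λ a a≤r → trans (cong (_* F a) (sub-≡-flipᵥ a r v a≤r))
              (trans (cong (_* F a) (*-comm (ind (vecEq a (r -ᵥ v))) _)) (*-assoc (ind (leqV v r)) _ _))) ⟩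
      BoxΣ r (λ a → ind (leqV v r) * (ind (vecEq a (r -ᵥ v)) * F a))
        ≡⟨ BoxΣ-*ˡ r (ind (leqV v r)) _ ⟩
      ind (leqV v r) * BoxΣ r (λ a → ind (vecEq a (r -ᵥ v)) * F a)
        ≡⟨ cong (ind (leqV v r) *_) (BoxΣ-delta r (r -ᵥ v) F) ⟩
      ind (leqV v r) * (ind (leqV (r -ᵥ v) r) * F (r -ᵥ v))
        ≡⟨ cong (λ b → ind (leqV v r) * (ind b * F (r -ᵥ v))) (sub-leq r v) ⟩
      ind (leqV v r) * (1 * F (r -ᵥ v))
        ≡⟨ cong (ind (leqV v r) *_) (*-identityˡ _) ⟩
      ind (leqV v r) * F (r -ᵥ v) ∎

Σ<-antidiagonal : ∀ B (G : ℕ → ℕ) → (∀ k → B ≤ k → G k ≡ 0) →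
  Σ< B (λ i → Σ< B (λ j → G (i + j))) ≡ Σ< B (λ k → (k + 1) * G k)
Σ<-antidiagonal B G vanish = begin
    Σ< B (λ i → Σ< B (λ j → G (i + j)))
      ≡⟨ Σ<-cong′ B (λ i → trans (shift i B G)
           (Σ<-extend B (i + B) (m≤n+m B i)
             (λ k p _ → trans (cong (ind (i ≤ᵇ k) *_) (vanish k p)) (*-zeroʳ (ind (i ≤ᵇ k)))))) ⟩
    Σ< B (λ i → Σ< B (λ k → ind (i ≤ᵇ k) * G k))
      ≡⟨ Σ<-swap B B _ ⟩
    Σ< B (λ k → Σ< B (λ i → ind (i ≤ᵇ k) * G k))
      ≡⟨ Σ<-cong B (λ k lt → trans (Σ<-*ʳ B (G k) (λ i → ind (i ≤ᵇ k))) (cong (_* G k) (count B k lt))) ⟩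
    Σ< B (λ k → (k + 1) * G k) ∎
  where
  open ≡-Reasoning
  shift : ∀ i B (G : ℕ → ℕ) → Σ< B (λ j → G (i + j)) ≡ Σ< (i + B) (λ k → ind (i ≤ᵇ k) * G k)
  shift zero B G = Σ<-cong′ B (λ k → sym (*-identityˡ (G k)))
  shift (suc i) B G =
    trans (shift i B (λ k → G (suc k)))
          (Σ<-cong′ (i + B) (λ k → cong (λ b → ind b * G (suc k)) (sym (suc≤ᵇsuc i k))))
  count : ∀ B k → k < B → Σ< B (λ i → ind (i ≤ᵇ k)) ≡ k + 1
  count (suc B) zero _ = cong (1 +_) (Σ<-zero B (λ _ _ → refl))
  count (suc B) (suc k) (s≤s lt) =
    cong (1 +_) (trans (Σ<-cong′ B (λ i → cong ind (suc≤ᵇsuc i k))) (count B k lt))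

geom²-weighted : ∀ {h} B (e : Vec ℕ h) → 1 ≤ V.sum e →
  WeightedGeom B (λ k → k + 1) e (geom (X^ e) · geom (X^ e))
geom²-weighted B e e-pos b lt = begin
    (geom (X^ e) · geom (X^ e)) b
      ≡⟨ weighted-· B (λ _ → 1) e (geom (X^ e)) (geom (X^ e)) (geom-weighted B e e-pos) b lt ⟩
    Σ< B (λ i → 1 * (ind (leqV (scale i e) b) * geom (X^ e) (b -ᵥ scale i e)))
      ≡⟨ Σ<-cong′ B (λ i → trans (*-identityˡ _) (expand i)) ⟩
    Σ< B (λ i → Σ< B (λ j → ind (vecEq b (scale (i + j) e))))
      ≡⟨ Σ<-antidiagonal B (λ k → ind (vecEq b (scale k e)))
           (λ k p → scale-too-big b e k e-pos (<-≤-trans lt p)) ⟩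
    Σ< B (λ k → (k + 1) * ind (vecEq b (scale k e))) ∎
  where
  open ≡-Reasoning
  expand : ∀ i → ind (leqV (scale i e) b) * geom (X^ e) (b -ᵥ scale i e)
               ≡ Σ< B (λ j → ind (vecEq b (scale (i + j) e)))
  expand i = begin
      ind (leqV (scale i e) b) * geom (X^ e) (b -ᵥ scale i e)
        ≡⟨ cong (ind (leqV (scale i e) b) *_)
             (geom-weighted B e e-pos (b -ᵥ scale i e) (≤-<-trans (sum-sub b (scale i e)) lt)) ⟩
      ind (leqV (scale i e) b) * Σ< B (λ j → 1 * ind (vecEq (b -ᵥ scale i e) (scale j e)))
        ≡⟨ sym (Σ<-*ˡ B (ind (leqV (scale i e) b)) _) ⟩
      Σ< B (λ j → ind (leqV (scale i e) b) * (1 * ind (vecEq (b -ᵥ scale i e) (scale j e))))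
        ≡⟨ Σ<-cong′ B (λ j → trans (cong (ind (leqV (scale i e) b) *_) (*-identityˡ _))
             (trans (sub-≡-iffᵥ (scale i e) b (scale j e))
                    (cong (λ v → ind (vecEq b v)) (scale-+ i j e)))) ⟩
      Σ< B (λ j → ind (vecEq b (scale (i + j) e))) ∎

Σ<-unique : ∀ B x₀ (P : ℕ → Bool) (F : ℕ → ℕ) → x₀ < B → P x₀ ≡ true →
  (∀ k → P k ≡ true → k ≡ x₀) → Σ< B (λ k → ind (P k) * F k) ≡ F x₀
Σ<-unique B x₀ P F lt px₀ unique =
  trans (Σ<-single B x₀ lt (λ i _ ne → off i ne))
        (trans (cong (λ b → ind b * F x₀) px₀) (*-identityˡ (F x₀)))
  where
  off : ∀ i → ¬ i ≡ x₀ → ind (P i) * F i ≡ 0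
  off i ne with P i in e
  ... | true = ⊥-elim (ne (unique i e))
  ... | false = refl

Σ<-none : ∀ B (P : ℕ → Bool) (F : ℕ → ℕ) → (∀ k → P k ≡ true → ⊥) → Σ< B (λ k → ind (P k) * F k) ≡ 0
Σ<-none B P F never = Σ<-zero B (λ k _ → off k)
  where
  off : ∀ k → ind (P k) * F k ≡ 0
  off k with P k in e
  ... | true = ⊥-elim (never k e)
  ... | false = refl

data DivCase (c v : ℕ) : Set where
  multiple : ∀ x₀ → c * x₀ ≡ v → DivCase c v
  nonmultiple : (∀ x → ¬ c * x ≡ v) → DivCase c v

divCase : ∀ c v → DivCase c v
divCase c v with c ∣? v
... | yes (divides q eq) = multiple q (trans (*-comm c q) (sym eq))
... | no c∤v = nonmultiple (λ x eq → c∤v (divides x (trans (sym eq) (*-comm c x))))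

Div : ℕ → ℕ → (ℕ → ℕ) → ℕ
Div c v F = Σ< (suc v) (λ x → ind ((c * x) ≡ᵇ v) * F x)

Div-multiple : ∀ c v F x₀ → 1 ≤ c → c * x₀ ≡ v → Div c v F ≡ F x₀
Div-multiple c v F x₀ c-pos eq =
  Σ<-unique (suc v) x₀ (λ x → (c * x) ≡ᵇ v) F
    (s≤s (subst (x₀ ≤_) eq (m≤n*m x₀ c {{>-nonZero c-pos}})))
    (≡ᵇ-complete eq)
    (λ k e → *-cancelˡ-≡ k x₀ c {{>-nonZero c-pos}} (trans (≡ᵇ-sound (c * k) v e) (sym eq)))

Div-nonmultiple : ∀ c v F → (∀ x → ¬ c * x ≡ v) → Div c v F ≡ 0
Div-nonmultiple c v F never = Σ<-none (suc v) (λ x → (c * x) ≡ᵇ v) F (λ k e → never k (≡ᵇ-sound (c * k) v e))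

Div-cong : ∀ c v {F G : ℕ → ℕ} → (∀ x → F x ≡ G x) → Div c v F ≡ Div c v G
Div-cong c v eq = Σ<-cong′ (suc v) (λ x → cong (ind ((c * x) ≡ᵇ v) *_) (eq x))

Div-*ʳ : ∀ c v F a → Div c v (λ x → F x * a) ≡ Div c v F * a
Div-*ʳ c v F a = trans (Σ<-cong′ (suc v) (λ x → sym (*-assoc (ind ((c * x) ≡ᵇ v)) (F x) a)))
                       (Σ<-*ʳ (suc v) a (λ x → ind ((c * x) ≡ᵇ v) * F x))

Div-*ˡ : ∀ c v F a → Div c v (λ x → a * F x) ≡ a * Div c v F
Div-*ˡ c v F a = trans (Div-cong c v (λ x → *-comm a (F x)))
                       (trans (Div-*ʳ c v F a) (*-comm (Div c v F) a))

-- Evaluation at a single point is multiplicative.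
Div-* : ∀ c v F G → 1 ≤ c → Div c v (λ x → F x * G x) ≡ Div c v F * Div c v G
Div-* c v F G c-pos with divCase c v
... | multiple x₀ eq rewrite Div-multiple c v (λ x → F x * G x) x₀ c-pos eq
                           | Div-multiple c v F x₀ c-pos eq | Div-multiple c v G x₀ c-pos eq = refl
... | nonmultiple never rewrite Div-nonmultiple c v (λ x → F x * G x) never
                              | Div-nonmultiple c v F never = refl

Div-shift : ∀ c v F G → 1 ≤ c → (∀ x → G (suc x) ≡ F x) → Div c v F ≡ Div c (c + v) G
Div-shift c v F G c-pos G-shift with divCase c v
... | multiple y eq = trans (Div-multiple c v F y c-pos eq)
    (sym (trans (Div-multiple c (c + v) G (suc y) c-pos (trans (*-suc c y) (cong (c +_) eq))) (G-shift y)))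
... | nonmultiple never = trans (Div-nonmultiple c v F never) (sym (Div-nonmultiple c (c + v) G never′))
  where
  never′ : ∀ x → ¬ c * x ≡ c + v
  never′ zero e = <⇒≢ (≤-trans c-pos (m≤m+n c v)) (trans (sym (*-zeroʳ c)) e)
  never′ (suc x) e = never x (+-cancelˡ-≡ c (c * x) v (trans (sym (*-suc c x)) e))

FactorΣ : ∀ {h} → Vec ℕ h → Vec ℕ h → (Vec ℕ h → ℕ) → ℕ
FactorΣ [] [] K = K []
FactorΣ (c ∷ n) (v ∷ r) K = Div c v (λ x → FactorΣ n r (λ d → K (x ∷ d)))

FactorΣ-cong : ∀ {h} (n r : Vec ℕ h) {K K' : Vec ℕ h → ℕ} → (∀ d → K d ≡ K' d) →
  FactorΣ n r K ≡ FactorΣ n r K'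
FactorΣ-cong [] [] eq = eq []
FactorΣ-cong (c ∷ n) (v ∷ r) eq = Div-cong c v (λ x → FactorΣ-cong n r (λ d → eq (x ∷ d)))

FactorΣ-*ˡ : ∀ {h} (n r : Vec ℕ h) a (K : Vec ℕ h → ℕ) → FactorΣ n r (λ d → a * K d) ≡ a * FactorΣ n r K
FactorΣ-*ˡ [] [] a K = refl
FactorΣ-*ˡ (c ∷ n) (v ∷ r) a K =
  trans (Div-cong c v (λ x → FactorΣ-*ˡ n r a (λ d → K (x ∷ d))))
        (Div-*ˡ c v (λ x → FactorΣ n r (λ d → K (x ∷ d))) a)

-- Iterated weighted sums: the coefficient of x^r in Π_{e ∈ es} (Σ_k w(k) x^{k e}) · T,
-- with each k ranging over [0, B).
Reps : ∀ {h} → ℕ → (ℕ → ℕ) → List (Vec ℕ h) → FPS h → FPS h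
Reps B w [] T r = T r
Reps B w (e ∷ es) T r = Σ< B (λ k → w k * (ind (leqV (scale k e) r) * Reps B w es T (r -ᵥ scale k e)))

Π-weighted : ∀ {h} B w (fac : Vec ℕ h → FPS h) (es : List (Vec ℕ h)) →
  All (λ e → WeightedGeom B w e (fac e)) es → ∀ r → V.sum r < B → Π (map fac es) r ≡ Reps B w es 𝟙 r
Π-weighted B w fac [] _ r lt = refl
Π-weighted B w fac (e ∷ es) (e-geom ∷ es-geom) r lt =
  trans (weighted-· B w e (fac e) (Π (map fac es)) e-geom r lt)
        (Σ<-cong′ B (λ k → cong (λ z → w k * (ind (leqV (scale k e) r) * z))
          (Π-weighted B w fac es es-geom _ (≤-<-trans (sum-sub r _) lt))))

Reps-++ : ∀ {h} B w (L₁ L₂ : List (Vec ℕ h)) T r → Reps B w (L₁ ++ L₂) T r ≡ Reps B w L₁ (Reps B w L₂ T) r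
Reps-++ B w [] L₂ T r = refl
Reps-++ B w (e ∷ L₁) L₂ T r =
  Σ<-cong′ B (λ k → cong (λ z → w k * (ind (leqV (scale k e) r) * z)) (Reps-++ B w L₁ L₂ T _))

Reps-cong : ∀ {h} B w (L : List (Vec ℕ h)) {T T' : FPS h} → (∀ r → T r ≡ T' r) →
  ∀ r → Reps B w L T r ≡ Reps B w L T' r
Reps-cong B w [] eq r = eq r
Reps-cong B w (e ∷ L) eq r =
  Σ<-cong′ B (λ k → cong (λ z → w k * (ind (leqV (scale k e) r) * z)) (Reps-cong B w L eq _))

outer : ∀ {h} → ℕ → Vec ℕ h → FPS h → FPS h
outer B e T r = Σ< B (λ k → ind (leqV (scale k e) r) * T (r -ᵥ scale k e))

-- An unweighted outer factor can be moved innermost (the factors commute).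
Reps-outer : ∀ {h} B w (e : Vec ℕ h) (L : List (Vec ℕ h)) (T : FPS h) r →
  outer B e (Reps B w L T) r ≡ Reps B w L (outer B e T) r
Reps-outer B w e [] T r = refl
Reps-outer B w e (f ∷ L) T r = begin
    Σ< B (λ k → ind (leqV (scale k e) r) * Σ< B (λ j → w j * inner k j))
      ≡⟨ Σ<-cong′ B (λ k → sym (Σ<-*ˡ B (ind (leqV (scale k e) r)) (λ j → w j * inner k j))) ⟩
    Σ< B (λ k → Σ< B (λ j → ind (leqV (scale k e) r) * (w j * inner k j)))
      ≡⟨ Σ<-swap B B _ ⟩
    Σ< B (λ j → Σ< B (λ k → ind (leqV (scale k e) r) * (w j * inner k j)))
      ≡⟨ Σ<-cong′ B (λ j → trans (Σ<-cong′ B (λ k → exchange j k)) (Σ<-*ˡ B (w j) _)) ⟩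
    Σ< B (λ j → w j * Σ< B (λ k → ind (leqV (scale j f) r) * (ind (leqV (scale k e) (r -ᵥ scale j f))
        * Reps B w L T (r -ᵥ scale j f -ᵥ scale k e))))
      ≡⟨ Σ<-cong′ B (λ j → cong (w j *_) (trans (Σ<-*ˡ B (ind (leqV (scale j f) r)) _)
           (cong (ind (leqV (scale j f) r) *_) (Reps-outer B w e L T (r -ᵥ scale j f))))) ⟩
    Σ< B (λ j → w j * (ind (leqV (scale j f) r) * Reps B w L (outer B e T) (r -ᵥ scale j f))) ∎
  where
  open ≡-Reasoning
  inner : ℕ → ℕ → ℕ
  inner k j = ind (leqV (scale j f) (r -ᵥ scale k e)) * Reps B w L T (r -ᵥ scale k e -ᵥ scale j f)
  reorder : ∀ a w b X → a * (w * (b * X)) ≡ w * ((a * b) * X)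
  reorder = solve-∀
  exchange : ∀ j k → ind (leqV (scale k e) r) * (w j * inner k j)
       ≡ w j * (ind (leqV (scale j f) r) * (ind (leqV (scale k e) (r -ᵥ scale j f))
           * Reps B w L T (r -ᵥ scale j f -ᵥ scale k e)))
  exchange j k rewrite -ᵥ-swap r (scale k e) (scale j f) =
    trans (reorder (ind (leqV (scale k e) r)) (w j) _ _)
    (trans (cong (λ z → w j * (z * Reps B w L T (r -ᵥ scale j f -ᵥ scale k e)))
                 (sub-≤-commᵥ (scale k e) (scale j f) r))
           (cong (w j *_) (*-assoc (ind (leqV (scale j f) r)) _ _)))

lastFactor : ∀ {h} → ℕ → Vec ℕ h → FPS h
lastFactor B n r = Σ< B (λ k → ind (vecEq r (scale k n)))

unit-shift : ∀ {h} (v r : Vec ℕ h) → ind (leqV v r) * 𝟙 (r -ᵥ v) ≡ ind (vecEq r v)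
unit-shift {h} v r = trans (sub-≡-iffᵥ v r (replicate h 0)) (cong (λ u → ind (vecEq r u)) (+-zeros v))
  where
  +-zeros : ∀ {h} (v : Vec ℕ h) → zipWith _+_ v (replicate h 0) ≡ v
  +-zeros [] = refl
  +-zeros (x ∷ v) = cong₂ _∷_ (+-identityʳ x) (+-zeros v)

outer-unit : ∀ {h} B (e r : Vec ℕ h) → outer B e 𝟙 r ≡ lastFactor B e r
outer-unit B e r = Σ<-cong′ B (λ k → unit-shift (scale k e) r)

Reps-unit : ∀ {h} B (e r : Vec ℕ h) → Reps B (λ _ → 1) (e ∷ []) 𝟙 r ≡ lastFactor B e r
Reps-unit B e r = Σ<-cong′ B (λ k → trans (*-identityˡ _) (unit-shift (scale k e) r))

cross : ∀ a c k → a * (k * c) ≡ c * (k * a)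
cross = solve-∀

ratio-base : ∀ a c k r₀ r₁ → 1 ≤ a → r₁ ≡ k * a → ind (r₀ ≡ᵇ (k * c)) ≡ ind ((c * r₁) ≡ᵇ (a * r₀))
ratio-base a c k r₀ r₁ a-pos r₁≡ka with r₀ ≟ k * c
... | yes eq rewrite ind≡ eq = sym (ind≡ {c * r₁} {a * r₀}
        (trans (cong (c *_) r₁≡ka) (trans (sym (cross a c k)) (cong (a *_) (sym eq)))))
... | no ne rewrite ind≢ ne = sym (ind≢ {c * r₁} {a * r₀} λ eq → ne (sym
        (*-cancelˡ-≡ (k * c) r₀ a {{>-nonZero a-pos}}
          (trans (cross a c k) (trans (cong (c *_) (sym r₁≡ka)) eq)))))

ratio-shift : ∀ a c k r₀ r₁ → 1 ≤ a → k * a ≤ r₁ →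
  ind ((k * c) ≤ᵇ r₀) * ind ((c * (r₁ ∸ k * a)) ≡ᵇ (a * (r₀ ∸ k * c))) ≡ ind ((c * r₁) ≡ᵇ (a * r₀))
ratio-shift a c k r₀ r₁ a-pos ka≤r₁ with k * c ≤? r₀
... | yes kc≤r₀ rewrite ind≤ kc≤r₀ = trans (*-identityˡ _) shifted
  where
  M = c * (k * a)
  left : c * (r₁ ∸ k * a) ≡ c * r₁ ∸ M
  left = *-distribˡ-∸ c r₁ (k * a)
  right : a * (r₀ ∸ k * c) ≡ a * r₀ ∸ M
  right = trans (*-distribˡ-∸ a r₀ (k * c)) (cong (a * r₀ ∸_) (cross a c k))
  M≤left : M ≤ c * r₁
  M≤left = *-monoʳ-≤ c ka≤r₁
  M≤right : M ≤ a * r₀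
  M≤right = subst (_≤ a * r₀) (cross a c k) (*-monoʳ-≤ a kc≤r₀)
  shifted : ind ((c * (r₁ ∸ k * a)) ≡ᵇ (a * (r₀ ∸ k * c))) ≡ ind ((c * r₁) ≡ᵇ (a * r₀))
  shifted with (c * r₁) ≟ (a * r₀)
  ... | yes e rewrite ind≡ e = ind≡ {c * (r₁ ∸ k * a)} {a * (r₀ ∸ k * c)}
          (trans left (trans (cong (_∸ M) e) (sym right)))
  ... | no ne rewrite ind≢ ne = ind≢ {c * (r₁ ∸ k * a)} {a * (r₀ ∸ k * c)} λ e →
          ne (∸-cancelʳ-≡ M≤left M≤right (trans (sym left) (trans e right)))
... | no kc≰r₀ rewrite ind≰ kc≰r₀ = sym (ind≢ {c * r₁} {a * r₀} λ e →
        <⇒≱ (*-monoʳ-< a {{>-nonZero a-pos}} (≰⇒> kc≰r₀))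
            (subst (a * (k * c) ≤_) e (subst (_≤ c * r₁) (sym (cross a c k)) (*-monoʳ-≤ c ka≤r₁))))

-- If every exponent has the form (c, a, …) then the
-- multiplicities contribute K c to the first and K a to the second
-- coordinate, so the first coordinate only imposes c r₁ = a r₀.
Reps-head-elim : ∀ {h} B w (c a : ℕ) → 1 ≤ a → (L : List (Vec ℕ (suc h))) → All (λ e → V.head e ≡ a) L →
  (e₃ : Vec ℕ h) → ∀ r₀ r₁ (rs : Vec ℕ h) →
  Reps B w (map (c ∷_) L) (lastFactor B (c ∷ a ∷ e₃)) (r₀ ∷ r₁ ∷ rs)
  ≡ ind ((c * r₁) ≡ᵇ (a * r₀)) * Reps B w L (lastFactor B (a ∷ e₃)) (r₁ ∷ rs)
Reps-head-elim B w c a a-pos [] [] e₃ r₀ r₁ rs =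
  trans (Σ<-cong′ B term) (Σ<-*ˡ B (ind ((c * r₁) ≡ᵇ (a * r₀))) _)
  where
  term : ∀ k → ind ((r₀ ≡ᵇ k * c) ∧ vecEq (r₁ ∷ rs) (scale k (a ∷ e₃)))
             ≡ ind ((c * r₁) ≡ᵇ (a * r₀)) * ind (vecEq (r₁ ∷ rs) (scale k (a ∷ e₃)))
  term k with vecEq (r₁ ∷ rs) (scale k (a ∷ e₃)) in e
  ... | true = trans (ind-∧ (r₀ ≡ᵇ k * c) true)
                 (cong (_* 1) (ratio-base a c k r₀ r₁ a-pos (cong V.head (vecEq-sound (r₁ ∷ rs) _ e))))
  ... | false = trans (ind-∧ (r₀ ≡ᵇ k * c) false)
                      (trans (*-zeroʳ (ind (r₀ ≡ᵇ k * c))) (sym (*-zeroʳ (ind ((c * r₁) ≡ᵇ (a * r₀))))))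
Reps-head-elim B w c a a-pos ((a ∷ e₁) ∷ L) (refl ∷ heads) e₃ r₀ r₁ rs =
  trans (Σ<-cong′ B term) (Σ<-*ˡ B (ind ((c * r₁) ≡ᵇ (a * r₀))) _)
  where
  rest : ℕ → ℕ
  rest k = Reps B w L (lastFactor B (a ∷ e₃)) ((r₁ ∸ k * a) ∷ rs -ᵥ scale k e₁)
  fits : ℕ → Bool
  fits k = (k * a ≤ᵇ r₁) ∧ leqV (scale k e₁) rs
  same-ratio : ∀ k → (ind (k * c ≤ᵇ r₀) * ind ((c * (r₁ ∸ k * a)) ≡ᵇ (a * (r₀ ∸ k * c))))
            * (w k * (ind (fits k) * rest k))
          ≡ ind ((c * r₁) ≡ᵇ (a * r₀)) * (w k * (ind (fits k) * rest k))
  same-ratio k with k * a ≤ᵇ r₁ in ka≤r₁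
  ... | true = cong (_* (w k * (ind (leqV (scale k e₁) rs) * rest k)))
                 (ratio-shift a c k r₀ r₁ a-pos (≤ᵇ-sound (k * a) r₁ ka≤r₁))
  ... | false rewrite *-zeroʳ (w k) =
    trans (*-zeroʳ (ind (k * c ≤ᵇ r₀) * ind ((c * (r₁ ∸ k * a)) ≡ᵇ (a * (r₀ ∸ k * c)))))
          (sym (*-zeroʳ (ind ((c * r₁) ≡ᵇ (a * r₀)))))
  term : ∀ k → w k * (ind ((k * c ≤ᵇ r₀) ∧ fits k)
           * Reps B w (map (c ∷_) L) (lastFactor B (c ∷ a ∷ e₃)) ((r₀ ∸ k * c) ∷ (r₁ ∸ k * a) ∷ rs -ᵥ scale k e₁))
         ≡ ind ((c * r₁) ≡ᵇ (a * r₀)) * (w k * (ind (fits k) * rest k))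
  term k = begin
      w k * (ind ((k * c ≤ᵇ r₀) ∧ fits k)
           * Reps B w (map (c ∷_) L) (lastFactor B (c ∷ a ∷ e₃)) ((r₀ ∸ k * c) ∷ (r₁ ∸ k * a) ∷ rs -ᵥ scale k e₁))
        ≡⟨ cong₂ (λ u v → w k * (u * v)) (ind-∧ (k * c ≤ᵇ r₀) (fits k))
             (Reps-head-elim B w c a a-pos L heads e₃ (r₀ ∸ k * c) (r₁ ∸ k * a) (rs -ᵥ scale k e₁)) ⟩
      w k * ((ind (k * c ≤ᵇ r₀) * ind (fits k)) * (ind ratio′ * rest k))
        ≡⟨ reorder (w k) (ind (k * c ≤ᵇ r₀)) (ind (fits k)) (ind ratio′) (rest k) ⟩
      (ind (k * c ≤ᵇ r₀) * ind ratio′) * (w k * (ind (fits k) * rest k))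
        ≡⟨ same-ratio k ⟩
      ind ((c * r₁) ≡ᵇ (a * r₀)) * (w k * (ind (fits k) * rest k)) ∎
    where
    open ≡-Reasoning
    ratio′ = (c * (r₁ ∸ k * a)) ≡ᵇ (a * (r₀ ∸ k * c))
    reorder : ∀ w A Q E Y → w * ((A * Q) * (E * Y)) ≡ (A * E) * (w * (Q * Y))
    reorder = solve-∀

-- The sum over the multiplicity k of the first exponent (n₀, 0, …, 0), once
-- the remaining coordinates have been eliminated, and its test on k.
firstSum : ℕ → (ℕ → ℕ) → ℕ → ℕ → ℕ → ℕ → ℕ
firstSum B w n₀ n₁ r₀ r₁ = Σ< B (λ k → w k * (ind (k * n₀ ≤ᵇ r₀) * ind ((n₀ * r₁) ≡ᵇ (n₁ * (r₀ ∸ k * n₀)))))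

firstTest : ℕ → ℕ → ℕ → ℕ → ℕ → Bool
firstTest n₀ n₁ r₀ r₁ k = (k * n₀ ≤ᵇ r₀) ∧ ((n₀ * r₁) ≡ᵇ (n₁ * (r₀ ∸ k * n₀)))

firstTest-sound : ∀ n₀ n₁ r₀ r₁ y₀ k → 1 ≤ n₁ → n₁ * y₀ ≡ r₁ →
  firstTest n₀ n₁ r₀ r₁ k ≡ true → r₀ ≡ n₀ * (y₀ + k)
firstTest-sound n₀ n₁ r₀ r₁ y₀ k n₁-pos n₁y₀≡r₁ test = begin
    r₀                     ≡⟨ sym (m∸n+n≡m kn₀≤r₀) ⟩
    (r₀ ∸ k * n₀) + k * n₀ ≡⟨ cong (_+ k * n₀) (sym rest) ⟩
    n₀ * y₀ + k * n₀       ≡⟨ distrib n₀ y₀ k ⟩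
    n₀ * (y₀ + k)          ∎
  where
  open ≡-Reasoning
  split = ∧-split {k * n₀ ≤ᵇ r₀} test
  kn₀≤r₀ : k * n₀ ≤ r₀
  kn₀≤r₀ = ≤ᵇ-sound (k * n₀) r₀ (proj₁ split)
  swap : ∀ n₀ n₁ y₀ → n₀ * (n₁ * y₀) ≡ n₁ * (n₀ * y₀)
  swap = solve-∀
  distrib : ∀ n₀ y₀ k → n₀ * y₀ + k * n₀ ≡ n₀ * (y₀ + k)
  distrib = solve-∀
  rest : n₀ * y₀ ≡ r₀ ∸ k * n₀
  rest = *-cancelˡ-≡ (n₀ * y₀) (r₀ ∸ k * n₀) n₁ {{>-nonZero n₁-pos}}
           (trans (sym (swap n₀ n₁ y₀))
             (trans (cong (n₀ *_) n₁y₀≡r₁) (≡ᵇ-sound (n₀ * r₁) _ (proj₂ split))))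

firstTest-complete : ∀ n₀ n₁ r₀ r₁ x₀ y₀ → n₁ * y₀ ≡ r₁ → n₀ * x₀ ≡ r₀ → y₀ ≤ x₀ →
  firstTest n₀ n₁ r₀ r₁ (x₀ ∸ y₀) ≡ true
firstTest-complete n₀ n₁ r₀ r₁ x₀ y₀ n₁y₀≡r₁ n₀x₀≡r₀ y₀≤x₀ =
  ∧-intro (≤ᵇ-complete (subst ((x₀ ∸ y₀) * n₀ ≤_) (sym r₀≡x₀n₀) (*-monoˡ-≤ n₀ (m∸n≤m x₀ y₀))))
          (≡ᵇ-complete (trans (cong (n₀ *_) (sym n₁y₀≡r₁))
            (trans (swap n₀ n₁ y₀) (cong (n₁ *_) (sym remainder)))))
  where
  r₀≡x₀n₀ : r₀ ≡ x₀ * n₀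
  r₀≡x₀n₀ = trans (sym n₀x₀≡r₀) (*-comm n₀ x₀)
  remainder : r₀ ∸ (x₀ ∸ y₀) * n₀ ≡ y₀ * n₀
  remainder = begin
      r₀ ∸ (x₀ ∸ y₀) * n₀             ≡⟨ cong₂ _∸_ r₀≡x₀n₀ (*-distribʳ-∸ n₀ x₀ y₀) ⟩
      x₀ * n₀ ∸ (x₀ * n₀ ∸ y₀ * n₀)   ≡⟨ m∸[m∸n]≡n (*-monoˡ-≤ n₀ y₀≤x₀) ⟩
      y₀ * n₀                         ∎
    where open ≡-Reasoning
  swap : ∀ n₀ n₁ y₀ → n₀ * (n₁ * y₀) ≡ n₁ * (y₀ * n₀)
  swap = solve-∀

firstSum-quotient : ∀ B w n₀ n₁ r₀ r₁ y₀ → 1 ≤ n₀ → 1 ≤ n₁ → r₀ < B → n₁ * y₀ ≡ r₁ →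
  firstSum B w n₀ n₁ r₀ r₁ ≡ Div n₀ r₀ (λ x → ind (y₀ ≤ᵇ x) * w (x ∸ y₀))
firstSum-quotient B w n₀ n₁ r₀ r₁ y₀ n₀-pos n₁-pos r₀<B n₁y₀≡r₁ =
  trans (Σ<-cong′ B (λ k → trans (cong (w k *_) (sym (ind-∧ (k * n₀ ≤ᵇ r₀) _))) (*-comm (w k) _)))
        (by-cases (divCase n₀ r₀))
  where
  P = firstTest n₀ n₁ r₀ r₁
  Q = λ x → ind (y₀ ≤ᵇ x) * w (x ∸ y₀)
  solves : ∀ k → P k ≡ true → r₀ ≡ n₀ * (y₀ + k)
  solves k = firstTest-sound n₀ n₁ r₀ r₁ y₀ k n₁-pos n₁y₀≡r₁
  by-cases : DivCase n₀ r₀ → Σ< B (λ k → ind (P k) * w k) ≡ Div n₀ r₀ Q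
  by-cases (nonmultiple never) =
    trans (Σ<-none B P w (λ k e → never (y₀ + k) (sym (solves k e))))
          (sym (Div-nonmultiple n₀ r₀ Q never))
  by-cases (multiple x₀ n₀x₀≡r₀) with y₀ ≤? x₀
  ... | no y₀≰x₀ =
    trans (Σ<-none B P w (λ k e → y₀≰x₀ (≤-trans (m≤m+n y₀ k) (≤-reflexive (quotient k e)))))
          (sym (trans (Div-multiple n₀ r₀ Q x₀ n₀-pos n₀x₀≡r₀) (cong (_* w (x₀ ∸ y₀)) (ind≰ y₀≰x₀))))
    where
    quotient : ∀ k → P k ≡ true → y₀ + k ≡ x₀
    quotient k e = *-cancelˡ-≡ (y₀ + k) x₀ n₀ {{>-nonZero n₀-pos}} (trans (sym (solves k e)) (sym n₀x₀≡r₀))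
  ... | yes y₀≤x₀ =
    trans (Σ<-unique B (x₀ ∸ y₀) P w (≤-<-trans (≤-trans (m∸n≤m x₀ y₀) x₀≤r₀) r₀<B)
                     (firstTest-complete n₀ n₁ r₀ r₁ x₀ y₀ n₁y₀≡r₁ n₀x₀≡r₀ y₀≤x₀) only)
          (sym (trans (Div-multiple n₀ r₀ Q x₀ n₀-pos n₀x₀≡r₀)
                      (trans (cong (_* w (x₀ ∸ y₀)) (ind≤ y₀≤x₀)) (*-identityˡ _))))
    where
    x₀≤r₀ : x₀ ≤ r₀
    x₀≤r₀ = subst (x₀ ≤_) n₀x₀≡r₀ (m≤n*m x₀ n₀ {{>-nonZero n₀-pos}})
    only : ∀ k → P k ≡ true → k ≡ x₀ ∸ y₀
    only k e = trans (sym (m+n∸m≡n y₀ k)) (cong (_∸ y₀)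
                 (*-cancelˡ-≡ (y₀ + k) x₀ n₀ {{>-nonZero n₀-pos}} (trans (sym (solves k e)) (sym n₀x₀≡r₀))))

firstSum-factor : ∀ B w n₀ n₁ r₀ r₁ G → 1 ≤ n₀ → 1 ≤ n₁ → r₀ < B →
  firstSum B w n₀ n₁ r₀ r₁ * Div n₁ r₁ G
  ≡ Div n₀ r₀ (λ x → Div n₁ r₁ (λ y → ind (y ≤ᵇ x) * w (x ∸ y))) * Div n₁ r₁ G
firstSum-factor B w n₀ n₁ r₀ r₁ G n₀-pos n₁-pos r₀<B with divCase n₁ r₁
... | nonmultiple never rewrite Div-nonmultiple n₁ r₁ G never =
  trans (*-zeroʳ (firstSum B w n₀ n₁ r₀ r₁))
        (sym (*-zeroʳ (Div n₀ r₀ (λ x → Div n₁ r₁ (λ y → ind (y ≤ᵇ x) * w (x ∸ y))))))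
... | multiple y₀ n₁y₀≡r₁ = cong (_* Div n₁ r₁ G)
  (trans (firstSum-quotient B w n₀ n₁ r₀ r₁ y₀ n₀-pos n₁-pos r₀<B n₁y₀≡r₁)
         (Div-cong n₀ r₀ (λ x → sym (Div-multiple n₁ r₁ (λ y → ind (y ≤ᵇ x) * w (x ∸ y)) y₀ n₁-pos n₁y₀≡r₁))))

-- For n = (n₀, …, n_{h-1}) let
-- prefixExps n list the exponents of x₁^{n₁}⋯x_j^{n_j} for j < h.  A term of
-- Π_j (Σ_k w(k) x^{k·prefix_j}) · Σ_k x^{k n} at x^r corresponds to a vector d
-- with nᵢ dᵢ = rᵢ, dᵢ being the total multiplicity of the factors involving
-- xᵢ; the multiplicity of the j-th factor is d_{j-1} - d_j.

prefixExps : ∀ {h} → Vec ℕ (suc h) → List (Vec ℕ (suc h))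
prefixExps (n₀ ∷ []) = []
prefixExps {suc h} (n₀ ∷ n₁ ∷ ns) = (n₀ ∷ replicate (suc h) 0) ∷ map (n₀ ∷_) (prefixExps (n₁ ∷ ns))

chainWeight : ∀ {h} → (ℕ → ℕ) → Vec ℕ (suc h) → ℕ
chainWeight w (d₀ ∷ []) = 1
chainWeight w (d₀ ∷ d₁ ∷ ds) = ind (d₁ ≤ᵇ d₀) * (w (d₀ ∸ d₁) * chainWeight w (d₁ ∷ ds))

AllBelow : ∀ {h} → ℕ → Vec ℕ h → Set
AllBelow B [] = ⊤
AllBelow B (x ∷ xs) = (x < B) × AllBelow B xs

allPos-head : ∀ {h} (x : ℕ) (xs : Vec ℕ h) → allPos (x ∷ xs) ≡ true → 1 ≤ x
allPos-head x xs e = ≤ᵇ-sound 1 x (proj₁ (∧-split {1 ≤ᵇ x} e))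

allPos-tail : ∀ {h} (x : ℕ) (xs : Vec ℕ h) → allPos (x ∷ xs) ≡ true → allPos xs ≡ true
allPos-tail x xs e = proj₂ (∧-split {1 ≤ᵇ x} e)

prefixExps-heads : ∀ {h} (n₀ : ℕ) (ns : Vec ℕ h) → All (λ e → V.head e ≡ n₀) (prefixExps (n₀ ∷ ns))
prefixExps-heads n₀ [] = []
prefixExps-heads n₀ (n₁ ∷ ns) = refl ∷ consed (prefixExps (n₁ ∷ ns))
  where
  consed : ∀ {h} (L : List (Vec ℕ h)) → All (λ e → V.head e ≡ n₀) (map (n₀ ∷_) L)
  consed [] = []
  consed (_ ∷ L) = refl ∷ consed L

Σ<-multiples : ∀ B c v → 1 ≤ c → v < B → Σ< B (λ k → ind ((v ≡ᵇ k * c) ∧ true)) ≡ Div c v (λ _ → 1)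
Σ<-multiples B c v c-pos v<B =
  trans (Σ<-cong′ B (λ k → trans (cong ind (∧-identityʳ (v ≡ᵇ k * c))) (sym (*-identityʳ _))))
        (by-cases (divCase c v))
  where
  P : ℕ → Bool
  P k = v ≡ᵇ k * c
  quotient : ∀ k → P k ≡ true → c * k ≡ v
  quotient k e = trans (*-comm c k) (sym (≡ᵇ-sound v (k * c) e))
  by-cases : DivCase c v → Σ< B (λ k → ind (P k) * 1) ≡ Div c v (λ _ → 1)
  by-cases (nonmultiple never) =
    trans (Σ<-none B P (λ _ → 1) (λ k e → never k (quotient k e))) (sym (Div-nonmultiple c v (λ _ → 1) never))
  by-cases (multiple x₀ cx₀≡v) = trans
    (Σ<-unique B x₀ P (λ _ → 1)
      (≤-<-trans (subst (x₀ ≤_) cx₀≡v (m≤n*m x₀ c {{>-nonZero c-pos}})) v<B)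
      (≡ᵇ-complete (trans (sym cx₀≡v) (*-comm c x₀)))
      (λ k e → *-cancelˡ-≡ k x₀ c {{>-nonZero c-pos}} (trans (quotient k e) (sym cx₀≡v))))
    (sym (Div-multiple c v (λ _ → 1) x₀ c-pos cx₀≡v))

zeros-scale : ∀ {h} k → scale k (replicate h 0) ≡ replicate h 0
zeros-scale {zero} k = refl
zeros-scale {suc h} k = cong₂ _∷_ (*-zeroʳ k) (zeros-scale k)

zeros-leq : ∀ {h} (r : Vec ℕ h) → leqV (replicate h 0) r ≡ true
zeros-leq [] = refl
zeros-leq (x ∷ r) = zeros-leq r

zeros-sub : ∀ {h} (r : Vec ℕ h) → r -ᵥ replicate h 0 ≡ r
zeros-sub [] = refl
zeros-sub (x ∷ r) = cong (x ∷_) (zeros-sub r)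

first-factor : ∀ {h} B w n₀ (L : List (Vec ℕ (suc (suc h)))) T r₀ (r : Vec ℕ (suc h)) →
  Reps B w ((n₀ ∷ replicate (suc h) 0) ∷ L) T (r₀ ∷ r)
  ≡ Σ< B (λ k → w k * (ind (k * n₀ ≤ᵇ r₀) * Reps B w L T ((r₀ ∸ k * n₀) ∷ r)))
first-factor {h} B w n₀ L T r₀ r = Σ<-cong′ B (λ k →
  cong (w k *_) (begin
    ind ((k * n₀ ≤ᵇ r₀) ∧ leqV (scale k zs) r) * Reps B w L T ((r₀ ∸ k * n₀) ∷ r -ᵥ scale k zs)
      ≡⟨ cong (λ v → ind ((k * n₀ ≤ᵇ r₀) ∧ leqV v r) * Reps B w L T ((r₀ ∸ k * n₀) ∷ r -ᵥ v)) (zeros-scale k) ⟩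
    ind ((k * n₀ ≤ᵇ r₀) ∧ leqV zs r) * Reps B w L T ((r₀ ∸ k * n₀) ∷ r -ᵥ zs)
      ≡⟨ cong₂ (λ b v → ind ((k * n₀ ≤ᵇ r₀) ∧ b) * Reps B w L T ((r₀ ∸ k * n₀) ∷ v)) (zeros-leq r) (zeros-sub r) ⟩
    ind ((k * n₀ ≤ᵇ r₀) ∧ true) * Reps B w L T ((r₀ ∸ k * n₀) ∷ r)
      ≡⟨ cong (λ b → ind b * Reps B w L T ((r₀ ∸ k * n₀) ∷ r)) (∧-identityʳ (k * n₀ ≤ᵇ r₀)) ⟩
    ind (k * n₀ ≤ᵇ r₀) * Reps B w L T ((r₀ ∸ k * n₀) ∷ r) ∎))
  where
  open ≡-Reasoning
  zs = replicate (suc h) 0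

Reps-prefixExps : ∀ {h} B w (n : Vec ℕ (suc h)) → allPos n ≡ true → ∀ r → AllBelow B r →
  Reps B w (prefixExps n) (lastFactor B n) r ≡ FactorΣ n r (chainWeight w)
Reps-prefixExps B w (n₀ ∷ []) n-pos (r₀ ∷ []) (r₀<B , _) = Σ<-multiples B n₀ r₀ (allPos-head n₀ [] n-pos) r₀<B
Reps-prefixExps B w (n₀ ∷ n₁ ∷ ns) n-pos (r₀ ∷ r₁ ∷ rs) (r₀<B , r<B) = begin
    Reps B w (prefixExps (n₀ ∷ n₁ ∷ ns)) (lastFactor B (n₀ ∷ n₁ ∷ ns)) (r₀ ∷ r₁ ∷ rs)
      ≡⟨ first-factor B w n₀ (map (n₀ ∷_) (prefixExps (n₁ ∷ ns))) (lastFactor B (n₀ ∷ n₁ ∷ ns)) r₀ (r₁ ∷ rs) ⟩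
    Σ< B (λ k → w k * (ind (k * n₀ ≤ᵇ r₀) * Reps B w (map (n₀ ∷_) (prefixExps (n₁ ∷ ns)))
                         (lastFactor B (n₀ ∷ n₁ ∷ ns)) ((r₀ ∸ k * n₀) ∷ r₁ ∷ rs)))
      ≡⟨ Σ<-cong′ B (λ k → cong (λ z → w k * (ind (k * n₀ ≤ᵇ r₀) * z))
           (trans (Reps-head-elim B w n₀ n₁ n₁-pos (prefixExps (n₁ ∷ ns)) (prefixExps-heads n₁ ns) ns (r₀ ∸ k * n₀) r₁ rs)
                  (cong (ind ((n₀ * r₁) ≡ᵇ (n₁ * (r₀ ∸ k * n₀))) *_) (Reps-prefixExps B w (n₁ ∷ ns) tail-pos (r₁ ∷ rs) r<B)))) ⟩
    Σ< B (λ k → w k * (ind (k * n₀ ≤ᵇ r₀) * (ind ((n₀ * r₁) ≡ᵇ (n₁ * (r₀ ∸ k * n₀))) * D)))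
      ≡⟨ trans (Σ<-cong′ B (λ k → regroup (w k) (ind (k * n₀ ≤ᵇ r₀)) _ D)) (Σ<-*ʳ B D _) ⟩
    firstSum B w n₀ n₁ r₀ r₁ * D
      ≡⟨ firstSum-factor B w n₀ n₁ r₀ r₁ tail n₀-pos n₁-pos r₀<B ⟩
    Div n₀ r₀ (λ x → Div n₁ r₁ (λ y → ind (y ≤ᵇ x) * w (x ∸ y))) * D
      ≡⟨ sym (Div-*ʳ n₀ r₀ (λ x → Div n₁ r₁ (λ y → ind (y ≤ᵇ x) * w (x ∸ y))) D) ⟩
    Div n₀ r₀ (λ x → Div n₁ r₁ (λ y → ind (y ≤ᵇ x) * w (x ∸ y)) * D)
      ≡⟨ Div-cong n₀ r₀ (λ x → sym (Div-* n₁ r₁ (λ y → ind (y ≤ᵇ x) * w (x ∸ y)) tail n₁-pos)) ⟩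
    Div n₀ r₀ (λ x → Div n₁ r₁ (λ y → (ind (y ≤ᵇ x) * w (x ∸ y)) * tail y))
      ≡⟨ Div-cong n₀ r₀ (λ x → Div-cong n₁ r₁ (λ y →
           trans (sym (FactorΣ-*ˡ ns rs (ind (y ≤ᵇ x) * w (x ∸ y)) (λ d → chainWeight w (y ∷ d))))
                 (FactorΣ-cong ns rs (λ d → *-assoc (ind (y ≤ᵇ x)) (w (x ∸ y)) (chainWeight w (y ∷ d)))))) ⟩
    FactorΣ (n₀ ∷ n₁ ∷ ns) (r₀ ∷ r₁ ∷ rs) (chainWeight w) ∎
  where
  open ≡-Reasoning
  n₀-pos = allPos-head n₀ (n₁ ∷ ns) n-pos
  tail-pos = allPos-tail n₀ (n₁ ∷ ns) n-pos
  n₁-pos = allPos-head n₁ ns tail-pos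
  D = FactorΣ (n₁ ∷ ns) (r₁ ∷ rs) (chainWeight w)
  tail : ℕ → ℕ
  tail y = FactorΣ ns rs (λ d → chainWeight w (y ∷ d))
  regroup : ∀ w a e d → w * (a * (e * d)) ≡ (w * (a * e)) * d
  regroup = solve-∀

-- From multiplicities d back to side lengths q = d + 1.

sucᵥ : ∀ {h} → Vec ℕ h → Vec ℕ h
sucᵥ [] = []
sucᵥ (x ∷ xs) = suc x ∷ sucᵥ xs

FactorΣ-shift : ∀ {h} (n r : Vec ℕ h) (K G : Vec ℕ h → ℕ) → allPos n ≡ true →
  (∀ d → G (sucᵥ d) ≡ K d) → FactorΣ n r K ≡ FactorΣ n (zipWith _+_ n r) G
FactorΣ-shift [] [] K G _ G-shift = sym (G-shift [])
FactorΣ-shift (c ∷ n) (v ∷ r) K G n-pos G-shift =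
  Div-shift c v (λ x → FactorΣ n r (λ d → K (x ∷ d))) (λ x → FactorΣ n (zipWith _+_ n r) (λ d → G (x ∷ d)))
    (allPos-head c n n-pos)
    (λ x → sym (FactorΣ-shift n r (λ d → K (x ∷ d)) (λ d → G (suc x ∷ d)) (allPos-tail c n n-pos)
                  (λ d → G-shift (x ∷ d))))

FactorΣ-as-BoxΣ : ∀ {h} (n m : Vec ℕ h) (K : Vec ℕ h → ℕ) →
  FactorΣ n m K ≡ BoxΣ m (λ q → ind (vecEq (zipWith _*_ n q) m) * K q)
FactorΣ-as-BoxΣ [] [] K = sym (*-identityˡ (K []))
FactorΣ-as-BoxΣ (c ∷ n) (v ∷ m) K = Σ<-cong′ (suc v) (λ x → begin
    ind ((c * x) ≡ᵇ v) * FactorΣ n m (λ d → K (x ∷ d))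
      ≡⟨ cong (ind ((c * x) ≡ᵇ v) *_) (FactorΣ-as-BoxΣ n m (λ d → K (x ∷ d))) ⟩
    ind ((c * x) ≡ᵇ v) * BoxΣ m (λ q → ind (vecEq (zipWith _*_ n q) m) * K (x ∷ q))
      ≡⟨ sym (BoxΣ-*ˡ m (ind ((c * x) ≡ᵇ v)) _) ⟩
    BoxΣ m (λ q → ind ((c * x) ≡ᵇ v) * (ind (vecEq (zipWith _*_ n q) m) * K (x ∷ q)))
      ≡⟨ BoxΣ-cong′ m (λ q → trans (sym (*-assoc (ind ((c * x) ≡ᵇ v)) _ _))
           (cong (_* K (x ∷ q)) (sym (ind-∧ ((c * x) ≡ᵇ v) (vecEq (zipWith _*_ n q) m))))) ⟩
    BoxΣ m (λ q → ind (((c * x) ≡ᵇ v) ∧ vecEq (zipWith _*_ n q) m) * K (x ∷ q)) ∎)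
  where open ≡-Reasoning

add-sub : ∀ {h} (n m : Vec ℕ h) → leqV n m ≡ true → zipWith _+_ n (m -ᵥ n) ≡ m
add-sub [] [] _ = refl
add-sub (x ∷ n) (y ∷ m) le = cong₂ _∷_ (m+[n∸m]≡n (≤ᵇ-sound x y (proj₁ split))) (add-sub n m (proj₂ split))
  where split = ∧-split {x ≤ᵇ y} le

AllBelow-sum : ∀ {h} B (r : Vec ℕ h) → V.sum r < B → AllBelow B r
AllBelow-sum B [] _ = _
AllBelow-sum B (x ∷ r) lt =
  ≤-<-trans (m≤m+n x (V.sum r)) lt , AllBelow-sum B r (≤-<-trans (m≤n+m (V.sum r) x) lt)

representations : ∀ {h} B w (m n : Vec ℕ (suc h)) (G : Vec ℕ (suc h) → ℕ) →
  allPos n ≡ true → leqV n m ≡ true → V.sum m < B → (∀ d → G (sucᵥ d) ≡ chainWeight w d) →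
  Reps B w (prefixExps n) (lastFactor B n) (m -ᵥ n) ≡ BoxΣ m (λ q → ind (vecEq (zipWith _*_ n q) m) * G q)
representations B w m n G n-pos n≤m m<B G-shift = begin
    Reps B w (prefixExps n) (lastFactor B n) (m -ᵥ n)
      ≡⟨ Reps-prefixExps B w n n-pos (m -ᵥ n) (AllBelow-sum B (m -ᵥ n) (≤-<-trans (sum-sub m n) m<B)) ⟩
    FactorΣ n (m -ᵥ n) (chainWeight w)
      ≡⟨ FactorΣ-shift n (m -ᵥ n) (chainWeight w) G n-pos G-shift ⟩
    FactorΣ n (zipWith _+_ n (m -ᵥ n)) G
      ≡⟨ cong (λ v → FactorΣ n v G) (add-sub n m n≤m) ⟩
    FactorΣ n m G
      ≡⟨ FactorΣ-as-BoxΣ n m G ⟩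
    BoxΣ m (λ q → ind (vecEq (zipWith _*_ n q) m) * G q) ∎
  where open ≡-Reasoning

chainWeight-𝒵 : ∀ {h} (d : Vec ℕ (suc h)) → 𝒵 (sucᵥ d) ≡ chainWeight (λ _ → 1) d
chainWeight-𝒵 (d₀ ∷ []) = refl
chainWeight-𝒵 (d₀ ∷ d₁ ∷ ds) = trans (ind-∧ (suc d₁ ≤ᵇ suc d₀) _)
  (cong₂ _*_ (cong ind (suc≤ᵇsuc d₁ d₀)) (trans (chainWeight-𝒵 (d₁ ∷ ds)) (sym (*-identityˡ _))))

chainWeight-𝒵▲ : ∀ {h} (d : Vec ℕ (suc h)) → 𝒵▲ (sucᵥ d) ≡ chainWeight (λ k → k + 1) d
chainWeight-𝒵▲ (d₀ ∷ []) = refl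
chainWeight-𝒵▲ (d₀ ∷ d₁ ∷ ds) =
  trans (cong (_* ((d₀ ∸ d₁ + 1) * gap (sucᵥ (d₁ ∷ ds)))) (ind-∧ (suc d₁ ≤ᵇ suc d₀) _))
  (trans (reorder (ind (suc d₁ ≤ᵇ suc d₀)) (ind (nonincr⁺ (sucᵥ (d₁ ∷ ds)))) (d₀ ∸ d₁ + 1) (gap (sucᵥ (d₁ ∷ ds))))
         (cong₂ (λ a b → ind a * ((d₀ ∸ d₁ + 1) * b)) (suc≤ᵇsuc d₁ d₀) (chainWeight-𝒵▲ (d₁ ∷ ds))))
  where
  reorder : ∀ a n g p → (a * n) * (g * p) ≡ a * (g * (n * p))
  reorder = solve-∀

applyUpTo-suc : ∀ (f : ℕ → ℕ) n → applyUpTo (suc ∘ f) n ≡ map suc (applyUpTo f n)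
applyUpTo-suc f zero = refl
applyUpTo-suc f (suc n) = cong (suc (f 0) ∷_) (applyUpTo-suc (f ∘ suc) n)

tabulate-zeros : ∀ {h} → tabulate {n = h} (λ (i : Fin h) → 0) ≡ replicate h 0
tabulate-zeros {zero} = refl
tabulate-zeros {suc h} = cong (0 ∷_) tabulate-zeros

pref-cons : ∀ {h} (n₀ : ℕ) (n' : Vec ℕ h) (js : List ℕ) →
  map (pref (n₀ ∷ n')) (map suc js) ≡ map (n₀ ∷_) (map (pref n') js)
pref-cons n₀ n' [] = refl
pref-cons n₀ n' (j ∷ js) = cong ((n₀ ∷ pref n' j) ∷_) (pref-cons n₀ n' js)

pref-list : ∀ {h} (n : Vec ℕ (suc h)) → map (pref n) (map suc (upTo h)) ≡ prefixExps n
pref-list (n₀ ∷ []) = refl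
pref-list {suc h} (n₀ ∷ n₁ ∷ ns) =
  cong₂ _∷_ (cong (n₀ ∷_) tabulate-zeros)
    (trans (cong (λ js → map (pref (n₀ ∷ n₁ ∷ ns)) (map suc js)) (applyUpTo-suc (λ j → j) h))
    (trans (pref-cons n₀ (n₁ ∷ ns) (map suc (upTo h)))
           (cong (map (n₀ ∷_)) (pref-list (n₁ ∷ ns)))))

pref-full : ∀ {h} (n : Vec ℕ h) → pref n h ≡ n
pref-full [] = refl
pref-full (x ∷ n) = cong (x ∷_) (pref-full n)

pref-list-full : ∀ {h} (n : Vec ℕ (suc h)) → map (pref n) (map suc (upTo (suc h))) ≡ prefixExps n ++ (n ∷ [])
pref-list-full {h} n = begin
    map (pref n) (map suc (upTo (suc h)))
      ≡⟨ cong (λ js → map (pref n) (map suc js)) (sym (upTo-∷ʳ h)) ⟩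
    map (pref n) (map suc (upTo h ++ (h ∷ [])))
      ≡⟨ cong (map (pref n)) (map-++ suc (upTo h) (h ∷ [])) ⟩
    map (pref n) (map suc (upTo h) ++ (suc h ∷ []))
      ≡⟨ map-++ (pref n) (map suc (upTo h)) (suc h ∷ []) ⟩
    map (pref n) (map suc (upTo h)) ++ (pref n (suc h) ∷ [])
      ≡⟨ cong₂ (λ a b → a ++ (b ∷ [])) (pref-list n) (pref-full n) ⟩
    prefixExps n ++ (n ∷ []) ∎
  where open ≡-Reasoning

-- Every exponent involved is nonzero (it starts with n₀ ≥ 1), so each
-- factor is a genuine geometric series.
exps-nonzero : ∀ {h} (n : Vec ℕ (suc h)) → allPos n ≡ true →
  All (λ e → 1 ≤ V.sum e) (prefixExps n ++ (n ∷ []))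
exps-nonzero (n₀ ∷ ns) n-pos =
  All.map (λ {e} → head-nonzero e) (++⁺ (prefixExps-heads n₀ ns) (refl ∷ []))
  where
  head-nonzero : ∀ {h} (e : Vec ℕ (suc h)) → V.head e ≡ n₀ → 1 ≤ V.sum e
  head-nonzero (x ∷ e) refl = ≤-trans (allPos-head n₀ ns n-pos) (m≤m+n x (V.sum e))

espalier-term : ∀ {h} (m n : Vec ℕ (suc h)) → allPos n ≡ true → leqV n m ≡ true →
  (X^ n · Π (map (invP n) (map suc (upTo (suc h))))) m
  ≡ BoxΣ m (λ q → ind (vecEq (zipWith _*_ n q) m) * 𝒵 q)
espalier-term {h} m n n-pos n≤m = begin
    (X^ n · P) m
      ≡⟨ X^-shift n P m ⟩
    ind (leqV n m) * P (m -ᵥ n)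
      ≡⟨ trans (cong (λ b → ind b * P (m -ᵥ n)) n≤m) (*-identityˡ _) ⟩
    P (m -ᵥ n)
      ≡⟨ cong (λ L → Π L (m -ᵥ n)) factors ⟩
    Π (map fac (prefixExps n ++ (n ∷ []))) (m -ᵥ n)
      ≡⟨ Π-weighted B one fac (prefixExps n ++ (n ∷ []))
           (All.map (λ {e} → geom-weighted B e) (exps-nonzero n n-pos)) (m -ᵥ n) (s≤s (sum-sub m n)) ⟩
    Reps B one (prefixExps n ++ (n ∷ [])) 𝟙 (m -ᵥ n)
      ≡⟨ Reps-++ B one (prefixExps n) (n ∷ []) 𝟙 (m -ᵥ n) ⟩
    Reps B one (prefixExps n) (Reps B one (n ∷ []) 𝟙) (m -ᵥ n)
      ≡⟨ Reps-cong B one (prefixExps n) (Reps-unit B n) (m -ᵥ n) ⟩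
    Reps B one (prefixExps n) (lastFactor B n) (m -ᵥ n)
      ≡⟨ representations B one m n 𝒵 n-pos n≤m ≤-refl chainWeight-𝒵 ⟩
    BoxΣ m (λ q → ind (vecEq (zipWith _*_ n q) m) * 𝒵 q) ∎
  where
  open ≡-Reasoning
  B = suc (V.sum m)
  one : ℕ → ℕ
  one _ = 1
  fac : Vec ℕ (suc h) → FPS (suc h)
  fac e = geom (X^ e)
  P = Π (map (invP n) (map suc (upTo (suc h))))
  factors : map (invP n) (map suc (upTo (suc h))) ≡ map fac (prefixExps n ++ (n ∷ []))
  factors = trans (map-∘ {g = fac} {f = pref n} (map suc (upTo (suc h)))) (cong (map fac) (pref-list-full n))

pyramid-term : ∀ {h} (m n : Vec ℕ (suc h)) → allPos n ≡ true → leqV n m ≡ true →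
  (X^ n · (Π (map (λ j → invP n j · invP n j) (map suc (upTo h))) · invP n (suc h))) m
  ≡ BoxΣ m (λ q → ind (vecEq (zipWith _*_ n q) m) * 𝒵▲ q)
pyramid-term {h} m n n-pos n≤m = begin
    (X^ n · (P · invP n (suc h))) m
      ≡⟨ X^-shift n (P · invP n (suc h)) m ⟩
    ind (leqV n m) * (P · invP n (suc h)) (m -ᵥ n)
      ≡⟨ trans (cong (λ b → ind b * (P · invP n (suc h)) (m -ᵥ n)) n≤m) (*-identityˡ _) ⟩
    (P · geom (X^ (pref n (suc h)))) (m -ᵥ n)
      ≡⟨ cong (λ e → (P · geom (X^ e)) (m -ᵥ n)) (pref-full n) ⟩
    (P · geom (X^ n)) (m -ᵥ n)
      ≡⟨ ·-geom B n n-nonzero P (m -ᵥ n) r<B ⟩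
    outer B n P (m -ᵥ n)
      ≡⟨ Σ<-cong′ B (λ k → cong (ind (leqV (scale k n) (m -ᵥ n)) *_)
           (trans (cong (λ L → Π L (m -ᵥ n -ᵥ scale k n)) factors)
                  (Π-weighted B sq fac² (prefixExps n) squares-weighted _
                    (≤-<-trans (sum-sub (m -ᵥ n) (scale k n)) r<B)))) ⟩
    outer B n (Reps B sq (prefixExps n) 𝟙) (m -ᵥ n)
      ≡⟨ Reps-outer B sq n (prefixExps n) 𝟙 (m -ᵥ n) ⟩
    Reps B sq (prefixExps n) (outer B n 𝟙) (m -ᵥ n)
      ≡⟨ Reps-cong B sq (prefixExps n) (outer-unit B n) (m -ᵥ n) ⟩
    Reps B sq (prefixExps n) (lastFactor B n) (m -ᵥ n)
      ≡⟨ representations B sq m n 𝒵▲ n-pos n≤m ≤-refl chainWeight-𝒵▲ ⟩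
    BoxΣ m (λ q → ind (vecEq (zipWith _*_ n q) m) * 𝒵▲ q) ∎
  where
  open ≡-Reasoning
  B = suc (V.sum m)
  r<B : V.sum (m -ᵥ n) < B
  r<B = s≤s (sum-sub m n)
  sq : ℕ → ℕ
  sq k = k + 1
  fac² : Vec ℕ (suc h) → FPS (suc h)
  fac² e = geom (X^ e) · geom (X^ e)
  P = Π (map (λ j → invP n j · invP n j) (map suc (upTo h)))
  factors : map (λ j → invP n j · invP n j) (map suc (upTo h)) ≡ map fac² (prefixExps n)
  factors = trans (map-∘ {g = fac²} {f = pref n} (map suc (upTo h))) (cong (map fac²) (pref-list n))
  nonzero = exps-nonzero n n-pos
  n-nonzero : 1 ≤ V.sum n
  n-nonzero = All.head (++⁻ʳ (prefixExps n) nonzero)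
  squares-weighted : All (λ e → WeightedGeom B sq e (fac² e)) (prefixExps n)
  squares-weighted = All.map (λ {e} → geom²-weighted B e) (++⁻ˡ (prefixExps n) nonzero)

rhsᵉ-Conv : ∀ {h} (m : Vec ℕ (suc h)) → rhsᵉ (suc h) m ≡ Conv 𝒵 𝒵 m
rhsᵉ-Conv {h} m = trans (Σ∈-box m _) (BoxΣ-cong m term)
  where
  term : ∀ n → leqV n m ≡ true →
    ind (nonincr⁺ n) * (X^ n · Π (map (invP n) (map suc (upTo (suc h))))) m
    ≡ BoxΣ m (λ q → ind (vecEq (zipWith _*_ n q) m) * (ind (nonincr⁺ n) * 𝒵 q))
  term n n≤m with nonincr⁺ n in n-nonincr
  ... | true = trans (*-identityˡ _) (trans (espalier-term m n (nonincr⇒allPos n n-nonincr) n≤m)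
                 (BoxΣ-cong′ m (λ q → cong (ind (vecEq (zipWith _*_ n q) m) *_) (sym (*-identityˡ _)))))
  ... | false = sym (BoxΣ-zero m (λ q → *-zeroʳ (ind (vecEq (zipWith _*_ n q) m))))

rhsᵖ-Conv : ∀ {h} (m : Vec ℕ (suc h)) → rhsᵖ (suc h) m ≡ Conv 𝒵▲ 𝒵▲ m
rhsᵖ-Conv {h} m = trans (Σ∈-box m _) (BoxΣ-cong m term)
  where
  regroup : ∀ g e z → g * (e * z) ≡ e * ((1 * g) * z)
  regroup = solve-∀
  term : ∀ n → leqV n m ≡ true →
    ind (nonincr⁺ n) * (gap n * (X^ n · (Π (map (λ j → invP n j · invP n j) (map suc (upTo h))) · invP n (suc h))) m)
    ≡ BoxΣ m (λ q → ind (vecEq (zipWith _*_ n q) m) * ((ind (nonincr⁺ n) * gap n) * 𝒵▲ q))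
  term n n≤m with nonincr⁺ n in n-nonincr
  ... | true = trans (*-identityˡ _) (trans (cong (gap n *_) (pyramid-term m n (nonincr⇒allPos n n-nonincr) n≤m))
                 (trans (sym (BoxΣ-*ˡ m (gap n) _))
                   (BoxΣ-cong′ m (λ q → regroup (gap n) (ind (vecEq (zipWith _*_ n q) m)) (𝒵▲ q)))))
  ... | false = sym (BoxΣ-zero m (λ q → *-zeroʳ (ind (vecEq (zipWith _*_ n q) m))))

theorem1 : (h : ℕ) → 1 ≤ h →
    ((m : Vec ℕ h) → allPos m ≡ true → 𝓔ᵉ-D m ≡ (𝒵 ⋆ 𝒵) m) ×
    ((m : Vec ℕ h) → allPos m ≡ true → 𝓔ᵖ-D m ≡ (𝒵▲ ⋆ 𝒵▲) m) ×
    ((m : Vec ℕ h) → 𝓔ᵉ m ≡ rhsᵉ h m) ×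
    ((m : Vec ℕ h) → 𝓔ᵖ m ≡ rhsᵖ h m)
theorem1 (suc h) _ =
  (λ m _ → trans (espalier-series m) (sym (⋆-as-Conv 𝒵 𝒵 m))) ,
  (λ m _ → trans (pyramid-series m) (sym (⋆-as-Conv 𝒵▲ 𝒵▲ m))) ,
  (λ m → trans (espalier-series m) (sym (rhsᵉ-Conv m))) ,
  (λ m → trans (pyramid-series m) (sym (rhsᵖ-Conv m)))
  where
  espalier-series : ∀ m → ind (nonincr⁺ m) * nᵉ m ≡ Conv 𝒵 𝒵 m
  espalier-series m = trans (cong (ind (nonincr⁺ m) *_) (espalier-count m))
                            (Conv-supported 𝒵-supported 𝒵-supported m)
  pyramid-series : ∀ m → ind (nonincr⁺ m) * nᵖ m ≡ Conv 𝒵▲ 𝒵▲ m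
  pyramid-series m = trans (cong (ind (nonincr⁺ m) *_) (pyramid-count m))
                           (Conv-supported 𝒵▲-supported 𝒵▲-supported m)
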